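{- Let $\Bbbk$ be a field of characteristic zero, $\beta\in\Bbbk^\times$, $b\in\Bbbk$, and let $A$ be the $\Bbbk$-algebra generated by $x,y,z$ subject to $$yz-zy=0,\qquad zx-\beta xz=b,\qquad xy-yx=0.$$ Then: (1) For all $m,n\in\mathbb{N}$, $y^nx^m=x^my^n$, $z^ny^m=y^mz^n$, and $$z^nx^m=\sum_{k=0}^{\min\{m,n\}}\beta^{(m-k)(n-k)}b^k\begin{bmatrix}n\\k\end{bmatrix}_\beta\begin{bmatrix}m\\k\end{bmatrix}_\beta[k]_\beta!\,x^{m-k}z^{n-k}.$$ Equivalently, defining scalars $W^{(m)}_{n,k}$ by $z^nx^m=\sum_{k=0}^{\min\{m,n\}}x^{m-k}W^{(m)}_{n,k}z^{n-k}$, one has $W^{(m)}_{0,0}=1$, $W^{(m)}_{0,k}=0$ ($k\ge1$), and $W^{(m)}_{n+1,k}=\beta^{m-k}W^{(m)}_{n,k}+b[m-k+1]_\beta W^{(m)}_{n,k-1}$ for $n,k\ge0$, $W^{(m)}_{n,-1}:=0$. (2) For all $m,n,s\in\mathbb{N}$, $(x^ny^m)^s=x^{ns}y^{ms}$ and $(y^nz^m)^s=y^{ns}z^{ms}$. Moreover $(x^nz^m)^s=\sum_{\ell=0}^{\min\{ns,ms\}}x^{ns-\ell}U^{(n,m)}_{s,\ell}z^{ms-\ell}$ with $U^{(n,m)}_{s,\ell}\in\Bbbk$, $U^{(n,m)}_{1,0}=1$, $U^{(n,m)}_{1,\ell}=0$ ($\ell\ge1$), and $U^{(n,m)}_{s+1,\ell}=\sum_{k=0}^{\min\{n,\ell\}}U^{(n,m)}_{s,\ell-k}W^{(n)}_{ms-(\ell-k),k}$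 for $s\ge1,\ell\ge0$. (3) $(xyz)^s=y^s(xz)^s$; in particular $(xyz)^s=\sum_{\ell=0}^sx^{s-\ell}V_{s,\ell}y^sz^{s-\ell}$ with $V_{s,\ell}\in\Bbbk$, $V_{1,0}=1$, $V_{1,\ell}=0$ ($\ell\ge1$), and $V_{s+1,\ell}=\beta^{s-\ell}V_{s,\ell}+b[s-\ell+1]_\beta V_{s,\ell-1}$ for $s\ge1,\ell\ge0$, $V_{s,-1}:=0$. (4) For $r,n,k\in\mathbb{N}$ define $\Theta_{r,n}(k):=\beta^{(n-k)(r-k)}b^k\frac{[r]^{\underline k}_\beta[n]^{\underline k}_\beta}{[k]_\beta!}=\beta^{(n-k)(r-k)}b^k\begin{bmatrix}r\\k\end{bmatrix}_\beta\begin{bmatrix}n\\k\end{bmatrix}_\beta[k]_\beta!$. Then for all $r,n\in\mathbb{N}$, $z^rx^n=\sum_{k=0}^{\min\{r,n\}}\Theta_{r,n}(k)x^{n-k}z^{r-k}$. For $s\ge1$ and $0\le\ell\le\min\{ns,ts\}$ set $$\mathcal C^{(n,t)}_{s,\ell}:=\sum_{\substack{k_1,\dots,k_{s-1}\ge0\\k_1+\cdots+k_{s-1}=\ell}}\ \prod_{j=1}^{s-1}\Theta_{tj-(k_1+\cdots+k_{j-1}),n}(k_j),$$ with $\mathcal C^{(n,t)}_{1,0}=1$ and $\mathcal C^{(n,t)}_{1,\ell}=0$ for $\ell\ge1$. Then for all $n,m,t,s\in\mathbb{N}$ (with $s\ge 1$), $$(x^ny^mz^t)^s=\sum_{\ell=0}^{\min\{ns,ts\}}x^{ns-\ell}y^{ms}\mathcal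 C^{(n,t)}_{s,\ell}z^{ts-\ell}.$$ (5) $(x+y)^n=\sum_{k=0}^n\binom nkx^{n-k}y^k$, $(y+z)^n=\sum_{k=0}^n\binom nky^{n-k}z^k$, and $(x+z)^n=\sum_{i,k\ge0,\ i+k\le n}x^iE_{n;i,k}z^k$ with $E_{n;i,k}\in\Bbbk[b]$, $E_{0;0,0}=1$, $E_{0;i,k}=0$ for $(i,k)\ne(0,0)$, and $E_{n+1;i,k}=E_{n;i,k-1}+\beta^kE_{n;i-1,k}+b[k+1]_\beta E_{n;i,k+1}$, where $E_{n;i,k}=0$ if $i<0$, $k<0$ or $i+k>n$.
   Context: $\mathbb{N}$ includes $0$. For $q\in\Bbbk^\times$: $[r]_q=1+q+\cdots+q^{r-1}$ ($[0]_q=0$), $[r]_q!=\prod_{j=1}^r[j]_q$ ($[0]_q!=1$), $[r]^{\underline k}_q=\prod_{j=0}^{k-1}[r-j]_q$ ($[r]^{\underline 0}_q=1$), $\begin{bmatrix}r\\k\end{bmatrix}_q=\frac{[r]_q!}{[r-k]_q![k]_q!}$ for $0\le k\le r$ and $0$ if $k>r$. The standard monomials $x^iy^jz^k$ form a $\Bbbk$-basis of $A$ (PBW basis). Coefficients with a negative index are zero; empty sums are $0$, empty products $1$. -}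

module Defs where

open import Level using (Level; _⊔_) renaming (suc to lsuc)
open import Algebra.Bundles using (CommutativeRing; Ring; Semiring)
open import Algebra.Morphism.Structures using (module RingMorphisms)
open import Data.Nat as ℕ using (ℕ; zero; suc; _∸_; _⊓_)
open import Data.Product using (Σ-syntax; _×_)
open import Relation.Nullary using (¬_)

-- Finite sums  Σ_{k=0}^{N} f k   (inclusive upper bound N)

module Sum {a} {A : Set a} (0# : A) (_+_ : A → A → A) where
  sumTo : ℕ → (ℕ → A) → A
  sumTo zero    f = f 0
  sumTo (suc N) f = sumTo N f + f (suc N)

module _ {c ℓ} (K : CommutativeRing c ℓ) where
  open CommutativeRing K hiding (zero)

  natK : ℕ → Carrier
  natK zero    = 0#
  natK (suc n) = 1# + natK n

  IsFieldCR : Set (c ⊔ ℓ)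
  IsFieldCR = (¬ (1# ≈ 0#)) ×
              (∀ a → ¬ (a ≈ 0#) → Σ[ a⁻¹ ∈ Carrier ] (a * a⁻¹ ≈ 1#))

  CharZero : Set ℓ
  CharZero = ∀ n → ¬ (natK (suc n) ≈ 0#)

module QCalc {c ℓ} (K : CommutativeRing c ℓ) where
  open CommutativeRing K hiding (zero)
  open import Algebra.Definitions.RawSemiring (Semiring.rawSemiring semiring) using (_^_)
  open Sum 0# _+_

  qint : Carrier → ℕ → Carrier
  qint q zero    = 0#
  qint q (suc r) = qint q r + q ^ r

  qfact : Carrier → ℕ → Carrier
  qfact q zero    = 1#
  qfact q (suc r) = qfact q r * qint q (suc r)

  -- Gaussian binomial [r k]_q, via the q-Pascal rule (polynomial in q);
  -- equals [r]!/([r-k]![k]!) whenever the latter is defined, and 0 for k > r.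
  qbinom : Carrier → ℕ → ℕ → Carrier
  qbinom q r       zero    = 1#
  qbinom q zero    (suc k) = 0#
  qbinom q (suc r) (suc k) = qbinom q r k + q ^ suc k * qbinom q r (suc k)

  module Coeffs (β b : Carrier) where

    δ : ℕ → Carrier
    δ zero    = 1#
    δ (suc _) = 0#

    zxCoeff : ℕ → ℕ → ℕ → Carrier
    zxCoeff n m k =
      β ^ ((m ∸ k) ℕ.* (n ∸ k)) * b ^ k * qbinom β n k * qbinom β m k * qfact β k

    W : ℕ → ℕ → ℕ → Carrier
    W m zero    k       = δ k
    W m (suc n) zero    = β ^ m * W m n zero
    W m (suc n) (suc k) =
      β ^ (m ∸ suc k) * W m n (suc k) + b * qint β (m ∸ k) * W m n k
      -- second term: b [m - (k+1) + 1]_β W^{(m)}_{n,k}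

    -- U^{(n,m)}_{s,ℓ}  (defined for s ≥ 1; the value at s = 0 is unused)
    U : ℕ → ℕ → ℕ → ℕ → Carrier
    U n m zero          l = δ l
    U n m (suc zero)    l = δ l
    U n m (suc (suc s)) l =
      sumTo (n ⊓ l) (λ k → U n m (suc s) (l ∸ k) * W n (m ℕ.* suc s ∸ (l ∸ k)) k)

    -- V_{s,ℓ}  (defined for s ≥ 1; the value at s = 0 is unused)
    V : ℕ → ℕ → Carrier
    V zero          l       = δ l
    V (suc zero)    l       = δ l
    V (suc (suc s)) zero    = β ^ suc s * V (suc s) zero
    V (suc (suc s)) (suc l) =
      β ^ (suc s ∸ suc l) * V (suc s) (suc l) + b * qint β (suc s ∸ l) * V (suc s) l
      -- second term: b [s - (l+1) + 1]_β V_{s,l}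

    Θ : ℕ → ℕ → ℕ → Carrier
    Θ r n k =
      β ^ ((n ∸ k) ℕ.* (r ∸ k)) * b ^ k * qbinom β r k * qbinom β n k * qfact β k

    -- Caux t n j c a ℓ  =  Σ_{k_j+...+k_{j+c-1} = ℓ}
    --        Π_{i=j}^{j+c-1} Θ_{t i - (a + k_j + ... + k_{i-1}), n}(k_i)
    Caux : ℕ → ℕ → ℕ → ℕ → ℕ → ℕ → Carrier
    Caux t n j zero    a l = δ l
    Caux t n j (suc c) a l =
      sumTo l (λ k → Θ (t ℕ.* j ∸ a) n k * Caux t n (suc j) c (a ℕ.+ k) (l ∸ k))

    𝒞 : ℕ → ℕ → ℕ → ℕ → Carrier
    𝒞 n t s l = Caux t n 1 (s ∸ 1) 0 l

    E : ℕ → ℕ → ℕ → Carrier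
    E zero    zero    zero    = 1#
    E zero    zero    (suc k) = 0#
    E zero    (suc i) k       = 0#
    E (suc n) i       k       = Ek-1 k + Ei-1 i + b * qint β (suc k) * E n i (suc k)
      where
      Ek-1 : ℕ → Carrier
      Ek-1 zero     = 0#
      Ek-1 (suc k') = E n i k'
      Ei-1 : ℕ → Carrier
      Ei-1 zero     = 0#
      Ei-1 (suc i') = β ^ k * E n i' k

-- The setting: a field K of characteristic 0, β ∈ K^×, b ∈ K, and a
-- K-algebra A (a ring with a central ring homomorphism ι : K → A)
-- containing elements x, y, z satisfying the defining relations.
-- (Identities proved for every such (A, x, y, z) are exactly the
--  identities in the algebra presented by generators and relations.)

record Setting (c ℓ c′ ℓ′ : Level) : Set (lsuc (c ⊔ ℓ ⊔ c′ ⊔ ℓ′)) where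
  field
    K         : CommutativeRing c ℓ
    isField   : IsFieldCR K
    charZero  : CharZero K
    β b       : CommutativeRing.Carrier K
    β≉0       : ¬ (CommutativeRing._≈_ K β (CommutativeRing.0# K))
    A         : Ring c′ ℓ′
    ι         : CommutativeRing.Carrier K → Ring.Carrier A
    ι-hom     : RingMorphisms.IsRingHomomorphism
                  (CommutativeRing.rawRing K) (Ring.rawRing A) ι
    ι-central : ∀ a u → Ring._≈_ A (Ring._*_ A (ι a) u) (Ring._*_ A u (ι a))
    x y z     : Ring.Carrier A
    rel-yz    : Ring._≈_ A (Ring._-_ A (Ring._*_ A y z) (Ring._*_ A z y)) (Ring.0# A)
    rel-zx    : Ring._≈_ A
                  (Ring._-_ A (Ring._*_ A z x) (Ring._*_ A (Ring._*_ A (ι β) x) z))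
                  (ι b)
    rel-xy    : Ring._≈_ A (Ring._-_ A (Ring._*_ A x y) (Ring._*_ A y x)) (Ring.0# A)

  open Ring A public hiding (zero)
  open import Algebra.Definitions.RawSemiring (Semiring.rawSemiring semiring) public using (_^_)
  open Sum 0# _+_ public
  open QCalc K public using (module Coeffs)
  open Coeffs β b public
  open import Data.Nat.Combinatorics public using (_C_)

  natA : ℕ → Carrier
  natA n = ι (natK K n)

{-# OPTIONS --safe #-}
module Submission where

-- Every product is rewritten as a sum of normal-ordered monomials x^i ι(a) z^k; y commutes with x and z
-- and is carried along. From z x = β x z + b one gets z x^j = β^j x^j z + b [j]_β x^(j-1), hence by
-- induction on n the expansion of z^n x^m with coefficients W, which obey the same recursion as the
-- closed form β^((m-k)(n-k)) b^k [n k]_β [m k]_β [k]_β! by the two q-Pascal rules. All powers then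
-- follow from one convolution principle: if every z^(B-l) Y is normal ordered, then so is
-- (∑_l x^(A-l) p_l z^(B-l)) Y, its coefficients being the convolution of p with those of the z^(B-l) Y.
-- Taking Y = x^n z^m, x z and (x^n z^t)^c gives U, V and 𝒞; multiplying (x+z)^n by x + z gives E.

open import Defs
open import Level using (Level)
open import Algebra.Bundles using (Semiring; CommutativeRing)
open import Algebra.Morphism.Structures using (module RingMorphisms)
open import Data.Nat as ℕ using (ℕ; zero; suc; _∸_; _⊓_; _≥_; _≤_; _<_; z≤n; s≤s)
import Data.Nat.Properties as ℕₚ
open import Data.Nat.Tactic.RingSolver using (solve-∀)
open import Data.Sum using (_⊎_; inj₁; inj₂)
open import Relation.Binary.PropositionalEquality as P using (_≡_; _≢_)
open import Relation.Nullary using (yes; no)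
open import Function using (_∘_)
open import Data.Empty using (⊥-elim)
open import Data.Fin using (toℕ)

m⊓n<o⇒m<o⊎n<o : ∀ {m n o} → m ⊓ n < o → m < o ⊎ n < o
m⊓n<o⇒m<o⊎n<o {m} {n} {o} m⊓n<o with ℕₚ.⊓-sel m n
... | inj₁ m⊓n≡m = inj₁ (P.subst (_< o) m⊓n≡m m⊓n<o)
... | inj₂ m⊓n≡n = inj₂ (P.subst (_< o) m⊓n≡n m⊓n<o)

m+n<o⇒n<o∸m : ∀ m {n o} → m ℕ.+ n < o → n < o ∸ m
m+n<o⇒n<o∸m zero    m+n<o           = m+n<o
m+n<o⇒n<o∸m (suc m) {o = suc o} (s≤s m+n<o) = m+n<o⇒n<o∸m m m+n<o

n≤m⇒m<n+o⇒m∸n<o : ∀ {m n o} → n ≤ m → m < n ℕ.+ o → m ∸ n < o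
n≤m⇒m<n+o⇒m∸n<o {m} {n} {o} n≤m m<n+o =
  P.subst (_≤ o) (ℕₚ.+-∸-assoc 1 n≤m) (ℕₚ.m≤n+o⇒m∸n≤o (suc m) n m<n+o)

n[s+2]⊓m[s+2]≤n[s+1]⊓m[s+1]+n : ∀ n m s → (n ℕ.* suc (suc s)) ⊓ (m ℕ.* suc (suc s)) ≤ (n ℕ.* suc s) ⊓ (m ℕ.* suc s) ℕ.+ n
n[s+2]⊓m[s+2]≤n[s+1]⊓m[s+1]+n n m s = P.subst (L ≤_) (P.sym (ℕₚ.+-distribʳ-⊓ n (n ℕ.* suc s) (m ℕ.* suc s))) (ℕₚ.⊓-glb L≤ L≤′)
  where
  L = (n ℕ.* suc (suc s)) ⊓ (m ℕ.* suc (suc s))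
  unfold : ∀ k s → k ℕ.* suc (suc s) ≡ k ℕ.* suc s ℕ.+ k
  unfold = solve-∀
  L≤ : L ≤ n ℕ.* suc s ℕ.+ n
  L≤ = ℕₚ.≤-trans (ℕₚ.m⊓n≤m _ _) (ℕₚ.≤-reflexive (unfold n s))
  L≤′ : L ≤ m ℕ.* suc s ℕ.+ n
  L≤′ with n ℕₚ.≤? m
  ... | yes n≤m = ℕₚ.≤-trans L≤ (ℕₚ.+-monoˡ-≤ n (ℕₚ.*-monoˡ-≤ (suc s) n≤m))
  ... | no  n≰m = ℕₚ.≤-trans (ℕₚ.m⊓n≤n _ _)
                    (ℕₚ.≤-trans (ℕₚ.≤-reflexive (unfold m s)) (ℕₚ.+-monoʳ-≤ (m ℕ.* suc s) (ℕₚ.<⇒≤ (ℕₚ.≰⇒> n≰m))))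

[m∸n]+[o∸p]≡m+o∸[n+p] : ∀ {m n o p} → n ≤ m → p ≤ o → (m ∸ n) ℕ.+ (o ∸ p) ≡ m ℕ.+ o ∸ (n ℕ.+ p)
[m∸n]+[o∸p]≡m+o∸[n+p] {m} {n} {o} {p} n≤m p≤o = P.trans (P.sym (ℕₚ.+-∸-comm (o ∸ p) n≤m))
  (P.trans (P.cong (_∸ n) (P.sym (ℕₚ.+-∸-assoc m p≤o)))
  (P.trans (ℕₚ.∸-+-assoc (m ℕ.+ o) p n) (P.cong (m ℕ.+ o ∸_) (ℕₚ.+-comm p n))))

a≤tj⇒a+k≤t[j+1] : ∀ t j a {k} → a ≤ t ℕ.* j → k ≤ t ℕ.* j ∸ a → a ℕ.+ k ≤ t ℕ.* suc j
a≤tj⇒a+k≤t[j+1] t j a a≤tj k≤tj∸a =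
  ℕₚ.≤-trans (ℕₚ.≤-trans (ℕₚ.+-monoʳ-≤ a k≤tj∸a) (ℕₚ.≤-reflexive (ℕₚ.m+[n∸m]≡n a≤tj)))
             (P.subst (t ℕ.* j ≤_) (P.sym (ℕₚ.*-suc t j)) (ℕₚ.m≤n+m (t ℕ.* j) t))

-- `a ⊓ c * s` parses as `(a ⊓ c) * s`; this is the range of the sums in parts (2) and (4) of the statement.
a⊓[c*s]≤[a⊓c]*s : ∀ a c s → a ⊓ (c ℕ.* suc s) ≤ a ⊓ c ℕ.* suc s
a⊓[c*s]≤[a⊓c]*s a c s = P.subst (a ⊓ (c ℕ.* suc s) ≤_) (P.sym (ℕₚ.*-distribʳ-⊓ (suc s) a c))
                          (ℕₚ.⊓-monoˡ-≤ (c ℕ.* suc s) (ℕₚ.m≤m*n a (suc s)))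

module FiniteSums {a ℓ} (R : Semiring a ℓ) where
  open Semiring R hiding (zero)
  open Sum 0# _+_
  open import Algebra.Properties.CommutativeSemigroup +-commutativeSemigroup using (interchange)
  open import Algebra.Properties.Semiring.Sum R using (sum⁺-syntax)
  open import Relation.Binary.Reasoning.Setoid setoid

  *-zeroˡ-≈ : ∀ {u} v → u ≈ 0# → u * v ≈ 0#
  *-zeroˡ-≈ v u≈0 = trans (*-congʳ u≈0) (zeroˡ v)

  *-zeroʳ-≈ : ∀ u {v} → v ≈ 0# → u * v ≈ 0#
  *-zeroʳ-≈ u v≈0 = trans (*-congˡ v≈0) (zeroʳ u)

  sumTo-cong : ∀ N {f g : ℕ → Carrier} → (∀ k → k ≤ N → f k ≈ g k) → sumTo N f ≈ sumTo N g
  sumTo-cong zero    f≈g = f≈g 0 z≤n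
  sumTo-cong (suc N) f≈g = +-cong (sumTo-cong N (λ k k≤N → f≈g k (ℕₚ.m≤n⇒m≤1+n k≤N))) (f≈g (suc N) ℕₚ.≤-refl)

  sumTo-+ : ∀ N (f g : ℕ → Carrier) → sumTo N (λ k → f k + g k) ≈ sumTo N f + sumTo N g
  sumTo-+ zero    f g = refl
  sumTo-+ (suc N) f g = trans (+-congʳ (sumTo-+ N f g)) (interchange _ _ _ _)

  *-distribˡ-sumTo : ∀ N a (f : ℕ → Carrier) → a * sumTo N f ≈ sumTo N (λ k → a * f k)
  *-distribˡ-sumTo zero    a f = refl
  *-distribˡ-sumTo (suc N) a f = trans (distribˡ a _ _) (+-congʳ (*-distribˡ-sumTo N a f))

  *-distribʳ-sumTo : ∀ N a (f : ℕ → Carrier) → sumTo N f * a ≈ sumTo N (λ k → f k * a)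
  *-distribʳ-sumTo zero    a f = refl
  *-distribʳ-sumTo (suc N) a f = trans (distribʳ a _ _) (+-congʳ (*-distribʳ-sumTo N a f))

  sumTo-head : ∀ N (f : ℕ → Carrier) → sumTo (suc N) f ≈ f 0 + sumTo N (f ∘ suc)
  sumTo-head zero    f = refl
  sumTo-head (suc N) f = trans (+-congʳ (sumTo-head N f)) (+-assoc _ _ _)

  sumTo-init : ∀ N (f : ℕ → Carrier) → f (suc N) ≈ 0# → sumTo (suc N) f ≈ sumTo N f
  sumTo-init N f f[N+1]≈0 = trans (+-congˡ f[N+1]≈0) (+-identityʳ _)

  sumTo-tail : ∀ N (f : ℕ → Carrier) → f 0 ≈ 0# → sumTo (suc N) f ≈ sumTo N (f ∘ suc)
  sumTo-tail N f f0≈0 = trans (sumTo-head N f) (trans (+-congʳ f0≈0) (+-identityˡ _))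

  sumTo-+-shift : ∀ N (f g : ℕ → Carrier) → f (suc N) ≈ 0# →
                  sumTo N f + sumTo N g ≈ f 0 + sumTo N (λ k → f (suc k) + g k)
  sumTo-+-shift N f g f[N+1]≈0 = begin
    sumTo N f + sumTo N g                   ≈⟨ +-congʳ (sumTo-init N f f[N+1]≈0) ⟨
    sumTo (suc N) f + sumTo N g             ≈⟨ +-congʳ (sumTo-head N f) ⟩
    f 0 + sumTo N (f ∘ suc) + sumTo N g     ≈⟨ +-assoc _ _ _ ⟩
    f 0 + (sumTo N (f ∘ suc) + sumTo N g)   ≈⟨ +-congˡ (sumTo-+ N (f ∘ suc) g) ⟨
    f 0 + sumTo N (λ k → f (suc k) + g k)   ∎

  sumTo-zero : ∀ N (f : ℕ → Carrier) → (∀ k → k ≤ N → f k ≈ 0#) → sumTo N f ≈ 0#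
  sumTo-zero zero    f f≈0 = f≈0 0 z≤n
  sumTo-zero (suc N) f f≈0 =
    trans (+-cong (sumTo-zero N f (λ k k≤N → f≈0 k (ℕₚ.m≤n⇒m≤1+n k≤N))) (f≈0 (suc N) ℕₚ.≤-refl))
          (+-identityˡ 0#)

  sumTo-extend : ∀ N M (f : ℕ → Carrier) → N ≤ M → (∀ k → N < k → k ≤ M → f k ≈ 0#) →
                 sumTo M f ≈ sumTo N f
  sumTo-extend N zero    f z≤n f≈0 = refl
  sumTo-extend N (suc M) f N≤M f≈0 with N ℕₚ.≟ suc M
  ... | yes P.refl = refl
  ... | no  N≢M    =
    trans (+-cong (sumTo-extend N M f (ℕₚ.≤-pred (ℕₚ.≤∧≢⇒< N≤M N≢M))
                    (λ k N<k k≤M → f≈0 k N<k (ℕₚ.m≤n⇒m≤1+n k≤M)))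
                  (f≈0 (suc M) (ℕₚ.≤∧≢⇒< N≤M N≢M) ℕₚ.≤-refl))
          (+-identityʳ _)

  sumTo-resize : ∀ L N M (f : ℕ → Carrier) → L ≤ N → L ≤ M → (∀ k → L < k → f k ≈ 0#) →
                 sumTo N f ≈ sumTo M f
  sumTo-resize L N M f L≤N L≤M f≈0 =
    trans (sumTo-extend L N f L≤N (λ k L<k _ → f≈0 k L<k))
          (sym (sumTo-extend L M f L≤M (λ k L<k _ → f≈0 k L<k)))

  sumTo-last : ∀ N (f : ℕ → Carrier) → (∀ k → k < N → f k ≈ 0#) → sumTo N f ≈ f N
  sumTo-last zero    f f≈0 = refl
  sumTo-last (suc N) f f≈0 = trans (+-congʳ (sumTo-zero N f (λ k k≤N → f≈0 k (s≤s k≤N)))) (+-identityˡ _)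

  sumTo-single : ∀ N i (f : ℕ → Carrier) → i ≤ N → (∀ k → k ≤ N → k ≢ i → f k ≈ 0#) →
                 sumTo N f ≈ f i
  sumTo-single N i f i≤N f≈0 =
    trans (sumTo-extend i N f i≤N (λ k i<k k≤N → f≈0 k k≤N (ℕₚ.>⇒≢ i<k)))
          (sumTo-last i f (λ k k<i → f≈0 k (ℕₚ.<⇒≤ (ℕₚ.<-≤-trans k<i i≤N)) (ℕₚ.<⇒≢ k<i)))

  sumTo-reverse : ∀ N (f : ℕ → Carrier) → sumTo N f ≈ sumTo N (λ k → f (N ∸ k))
  sumTo-reverse zero    f = refl
  sumTo-reverse (suc N) f = begin
    sumTo N f + f (suc N)                 ≈⟨ +-comm _ _ ⟩
    f (suc N) + sumTo N f                 ≈⟨ +-congˡ (sumTo-reverse N f) ⟩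
    f (suc N) + sumTo N (λ k → f (N ∸ k)) ≈⟨ sumTo-head N (λ k → f (suc N ∸ k)) ⟨
    sumTo (suc N) (λ k → f (suc N ∸ k))   ∎

  sumTo-antidiagonal : ∀ N (g : ℕ → ℕ → Carrier) →
    sumTo N (λ j → sumTo j (λ l → g l (j ∸ l))) ≈ sumTo N (λ l → sumTo (N ∸ l) (g l))
  sumTo-antidiagonal zero    g = refl
  sumTo-antidiagonal (suc N) g = begin
    sumTo N (λ j → sumTo j (λ l → g l (j ∸ l))) + sumTo (suc N) (λ l → g l (suc N ∸ l))
      ≈⟨ +-congʳ (sumTo-antidiagonal N g) ⟩
    sumTo N (λ l → sumTo (N ∸ l) (g l)) + (sumTo N (λ l → g l (suc N ∸ l)) + g (suc N) (N ∸ N))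
      ≈⟨ +-assoc _ _ _ ⟨
    sumTo N (λ l → sumTo (N ∸ l) (g l)) + sumTo N (λ l → g l (suc N ∸ l)) + g (suc N) (N ∸ N)
      ≈⟨ +-congʳ (sumTo-+ N _ _) ⟨
    sumTo N (λ l → sumTo (N ∸ l) (g l) + g l (suc N ∸ l)) + g (suc N) (N ∸ N)
      ≈⟨ +-cong (sumTo-cong N column) (P.subst (λ e → g (suc N) e ≈ sumTo e (g (suc N))) (P.sym (ℕₚ.n∸n≡0 N)) refl) ⟩
    sumTo (suc N) (λ l → sumTo (suc N ∸ l) (g l)) ∎
    where
    column : ∀ l → l ≤ N → sumTo (N ∸ l) (g l) + g l (suc N ∸ l) ≈ sumTo (suc N ∸ l) (g l)
    column l l≤N rewrite ℕₚ.+-∸-assoc 1 l≤N = refl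

  sumTo-rectangle : ∀ N M (g : ℕ → ℕ → Carrier) →
    (∀ l k → N < l → g l k ≈ 0#) → (∀ l k → M < k → g l k ≈ 0#) →
    sumTo N (λ l → sumTo M (g l)) ≈ sumTo (N ℕ.+ M) (λ j → sumTo j (λ l → g l (j ∸ l)))
  sumTo-rectangle N M g g≈0ˡ g≈0ʳ = begin
    sumTo N (λ l → sumTo M (g l))
      ≈⟨ sumTo-cong N (λ l l≤N → sym (sumTo-extend M (N ℕ.+ M ∸ l) (g l) (M≤ l l≤N) (λ k M<k _ → g≈0ʳ l k M<k))) ⟩
    sumTo N (λ l → sumTo (N ℕ.+ M ∸ l) (g l))
      ≈⟨ sumTo-extend N (N ℕ.+ M) _ (ℕₚ.m≤m+n N M) (λ l N<l _ → sumTo-zero (N ℕ.+ M ∸ l) (g l) (λ k _ → g≈0ˡ l k N<l)) ⟨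
    sumTo (N ℕ.+ M) (λ l → sumTo (N ℕ.+ M ∸ l) (g l))
      ≈⟨ sumTo-antidiagonal (N ℕ.+ M) g ⟨
    sumTo (N ℕ.+ M) (λ j → sumTo j (λ l → g l (j ∸ l))) ∎
    where
    M≤ : ∀ l → l ≤ N → M ≤ N ℕ.+ M ∸ l
    M≤ l l≤N = P.subst (M ≤_) (P.sym (ℕₚ.+-∸-comm M l≤N)) (ℕₚ.m≤n+m M (N ∸ l))

  ∑∑ : ℕ → (ℕ → ℕ → Carrier) → Carrier
  ∑∑ N f = sumTo N (λ i → sumTo N (f i))

  ∑∑-cong : ∀ N {f g : ℕ → ℕ → Carrier} → (∀ i k → f i k ≈ g i k) → ∑∑ N f ≈ ∑∑ N g
  ∑∑-cong N f≈g = sumTo-cong N (λ i _ → sumTo-cong N (λ k _ → f≈g i k))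

  ∑∑-+ : ∀ N (f g : ℕ → ℕ → Carrier) → ∑∑ N (λ i k → f i k + g i k) ≈ ∑∑ N f + ∑∑ N g
  ∑∑-+ N f g = trans (sumTo-cong N (λ i _ → sumTo-+ N (f i) (g i))) (sumTo-+ N _ _)

  *-distribʳ-∑∑ : ∀ N (f : ℕ → ℕ → Carrier) u → ∑∑ N f * u ≈ ∑∑ N (λ i k → f i k * u)
  *-distribʳ-∑∑ N f u = trans (*-distribʳ-sumTo N u _) (sumTo-cong N (λ i _ → *-distribʳ-sumTo N u (f i)))

  convolution : (ℕ → Carrier) → (ℕ → ℕ → Carrier) → ℕ → Carrier
  convolution p q j = sumTo j (λ l → p l * q l (j ∸ l))

  convolution≈0 : ∀ N M (p : ℕ → Carrier) (q : ℕ → ℕ → Carrier) →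
    (∀ l → N < l → p l ≈ 0#) → (∀ l k → M < k → q l k ≈ 0#) →
    ∀ j → N ℕ.+ M < j → convolution p q j ≈ 0#
  convolution≈0 N M p q p≈0 q≈0 j N+M<j = sumTo-zero j _ term
    where
    term : ∀ l → l ≤ j → p l * q l (j ∸ l) ≈ 0#
    term l _ with N ℕₚ.<? l
    ... | yes N<l = *-zeroˡ-≈ _ (p≈0 l N<l)
    ... | no  N≮l = *-zeroʳ-≈ _ (q≈0 l (j ∸ l) (m+n<o⇒n<o∸m l (ℕₚ.≤-<-trans (ℕₚ.+-monoˡ-≤ M (ℕₚ.≮⇒≥ N≮l)) N+M<j)))

  sumTo≈∑ : ∀ N (f : ℕ → Carrier) → sumTo N f ≈ ∑[ k ≤ N ] f (toℕ k)
  sumTo≈∑ zero    f = sym (+-identityʳ (f 0))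
  sumTo≈∑ (suc N) f = trans (sumTo-head N f) (+-congˡ (sumTo≈∑ N (f ∘ suc)))

module QCalculus {k ℓ} (K : CommutativeRing k ℓ) where
  open CommutativeRing K hiding (zero)
  open QCalc K
  open FiniteSums semiring using (*-zeroˡ-≈; *-zeroʳ-≈)
  open import Algebra.Properties.Semiring.Exp semiring using (_^_; ^-homo-*)
  open import Algebra.Solver.Ring.NaturalCoefficients.Default commutativeSemiring
    using (solve; _:=_; _:+_; _:*_)
  open import Relation.Binary.Reasoning.Setoid setoid

  qint-suc : ∀ q j → qint q (suc j) ≈ 1# + q * qint q j
  qint-suc q zero    = trans (+-identityˡ 1#) (sym (trans (+-congˡ (zeroʳ q)) (+-identityʳ 1#)))
  qint-suc q (suc j) = begin
    qint q (suc j) + q * q ^ j      ≈⟨ +-congʳ (qint-suc q j) ⟩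
    (1# + q * qint q j) + q * q ^ j ≈⟨ solve 4 (λ o q a p → (o :+ q :* a) :+ q :* p := o :+ q :* (a :+ p)) refl 1# q (qint q j) (q ^ j) ⟩
    1# + q * (qint q j + q ^ j)     ∎

  qint-+ : ∀ q a b → qint q (a ℕ.+ b) ≈ qint q a + q ^ a * qint q b
  qint-+ q zero    b = sym (trans (+-identityˡ _) (*-identityˡ _))
  qint-+ q (suc a) b = begin
    qint q (suc (a ℕ.+ b))                 ≈⟨ qint-suc q (a ℕ.+ b) ⟩
    1# + q * qint q (a ℕ.+ b)              ≈⟨ +-congˡ (*-congˡ (qint-+ q a b)) ⟩
    1# + q * (qint q a + q ^ a * qint q b)
      ≈⟨ solve 5 (λ o q x p y → o :+ q :* (x :+ p :* y) := (o :+ q :* x) :+ (q :* p) :* y)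
               refl 1# q (qint q a) (q ^ a) (qint q b) ⟩
    (1# + q * qint q a) + q ^ suc a * qint q b ≈⟨ +-congʳ (qint-suc q a) ⟨
    qint q (suc a) + q ^ suc a * qint q b  ∎

  r<k⇒qbinom≈0 : ∀ q {r k} → r < k → qbinom q r k ≈ 0#
  r<k⇒qbinom≈0 q {zero}  {suc k} _         = refl
  r<k⇒qbinom≈0 q {suc r} {suc k} (s≤s r<k) =
    trans (+-cong (r<k⇒qbinom≈0 q r<k) (*-zeroʳ-≈ _ (r<k⇒qbinom≈0 q (ℕₚ.m≤n⇒m≤1+n r<k))))
          (+-identityˡ 0#)

  qbinom-1 : ∀ q m → qbinom q m 1 ≈ qint q m
  qbinom-1 q zero    = refl
  qbinom-1 q (suc m) = begin
    1# + q * 1# * qbinom q m 1 ≈⟨ +-congˡ (*-cong (*-identityʳ q) (qbinom-1 q m)) ⟩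
    1# + q * qint q m          ≈⟨ qint-suc q m ⟨
    qint q (suc m)             ∎

  qfalling : Carrier → ℕ → ℕ → Carrier
  qfalling q m zero    = 1#
  qfalling q m (suc k) = qfalling q m k * qint q (m ∸ k)

  qfalling-suc : ∀ q m k → qfalling q (suc m) (suc k) ≈ qint q (suc m) * qfalling q m k
  qfalling-suc q m zero    = *-comm _ _
  qfalling-suc q m (suc k) = trans (*-congʳ (qfalling-suc q m k)) (*-assoc _ _ _)

  m<k⇒qfalling≈0 : ∀ q {m k} → m < k → qfalling q m k ≈ 0#
  m<k⇒qfalling≈0 q {m} {suc k} (s≤s m≤k) =
    *-zeroʳ-≈ _ (reflexive (P.cong (qint q) (ℕₚ.m≤n⇒m∸n≡0 m≤k)))

  qbinom*qfact≈qfalling : ∀ q m k → qbinom q m k * qfact q k ≈ qfalling q m k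
  qbinom*qfact≈qfalling q m       zero    = *-identityˡ 1#
  qbinom*qfact≈qfalling q zero    (suc k) = trans (zeroˡ _) (sym (m<k⇒qfalling≈0 q {k = suc k} (s≤s z≤n)))
  qbinom*qfact≈qfalling q (suc m) (suc k) = begin
    (qbinom q m k + q ^ suc k * qbinom q m (suc k)) * (qfact q k * qint q (suc k))
      ≈⟨ solve 5 (λ a p b f i → (a :+ p :* b) :* (f :* i) := (a :* f) :* i :+ p :* (b :* (f :* i))) refl
           (qbinom q m k) (q ^ suc k) (qbinom q m (suc k)) (qfact q k) (qint q (suc k)) ⟩
    (qbinom q m k * qfact q k) * qint q (suc k) + q ^ suc k * (qbinom q m (suc k) * qfact q (suc k))
      ≈⟨ +-cong (*-congʳ (qbinom*qfact≈qfalling q m k)) (*-congˡ (qbinom*qfact≈qfalling q m (suc k))) ⟩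
    F * qint q (suc k) + q ^ suc k * (F * qint q (m ∸ k))
      ≈⟨ solve 4 (λ F i p j → F :* i :+ p :* (F :* j) := F :* (i :+ p :* j)) refl F (qint q (suc k)) (q ^ suc k) (qint q (m ∸ k)) ⟩
    F * (qint q (suc k) + q ^ suc k * qint q (m ∸ k))
      ≈⟨ last (k ℕₚ.≤? m) ⟩
    qfalling q (suc m) (suc k) ∎
    where
    F = qfalling q m k
    last : _ → F * (qint q (suc k) + q ^ suc k * qint q (m ∸ k)) ≈ qfalling q (suc m) (suc k)
    last (yes k≤m) = begin
      F * (qint q (suc k) + q ^ suc k * qint q (m ∸ k)) ≈⟨ *-congˡ (qint-+ q (suc k) (m ∸ k)) ⟨
      F * qint q (suc k ℕ.+ (m ∸ k))                    ≈⟨ *-congˡ (reflexive (P.cong (qint q ∘ suc) (ℕₚ.m+[n∸m]≡n k≤m))) ⟩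
      F * qint q (suc m)                                ≈⟨ *-comm _ _ ⟩
      qint q (suc m) * F                                ≈⟨ qfalling-suc q m k ⟨
      qfalling q (suc m) (suc k)                        ∎
    last (no k≰m) = trans (*-zeroˡ-≈ _ (m<k⇒qfalling≈0 q m<k))
                          (sym (m<k⇒qfalling≈0 q (s≤s m<k)))
      where m<k = ℕₚ.≰⇒> k≰m

  ^-qbinom-cong : ∀ q r k {e e′} → (k < r → e ≡ e′) → q ^ e * qbinom q r (suc k) ≈ q ^ e′ * qbinom q r (suc k)
  ^-qbinom-cong q r k e≡e′ with suc k ℕₚ.≤? r
  ... | yes k<r = reflexive (P.cong (λ e → q ^ e * qbinom q r (suc k)) (e≡e′ k<r))
  ... | no  k≮r = trans (*-zeroʳ-≈ _ B≈0) (sym (*-zeroʳ-≈ _ B≈0))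
    where B≈0 = r<k⇒qbinom≈0 q (ℕₚ.≰⇒> k≮r)

  qbinom-pascal′ : ∀ q r k → qbinom q (suc r) (suc k) ≈ q ^ (r ∸ k) * qbinom q r k + qbinom q r (suc k)
  qbinom-pascal′ q zero    zero    = trans (+-congˡ (zeroʳ _)) (sym (+-congʳ (*-identityˡ 1#)))
  qbinom-pascal′ q zero    (suc k) = trans (+-congˡ (zeroʳ _)) (sym (+-congʳ (zeroʳ _)))
  qbinom-pascal′ q (suc r) zero    = begin
    1# + q * 1# * qbinom q (suc r) 1  ≈⟨ +-congˡ (*-cong (*-identityʳ q) (qbinom-1 q (suc r))) ⟩
    1# + q * qint q (suc r)           ≈⟨ qint-suc q (suc r) ⟨
    qint q (suc r) + q ^ suc r        ≈⟨ +-comm _ _ ⟩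
    q ^ suc r + qint q (suc r)        ≈⟨ +-cong (*-identityʳ _) (qbinom-1 q (suc r)) ⟨
    q ^ suc r * 1# + qbinom q (suc r) 1 ∎
  qbinom-pascal′ q (suc r) (suc k) = begin
    qbinom q (suc r) (suc k) + c * qbinom q (suc r) (suc (suc k))
      ≈⟨ +-cong (qbinom-pascal′ q r k) (*-congˡ (qbinom-pascal′ q r (suc k))) ⟩
    (a * B₀ + B₁) + c * (q ^ (r ∸ suc k) * B₁ + B₂)
      ≈⟨ solve 6 (λ a B₀ B₁ c d B₂ → (a :* B₀ :+ B₁) :+ c :* (d :* B₁ :+ B₂) := (a :* B₀ :+ B₁) :+ (c :* d) :* B₁ :+ c :* B₂)
               refl a B₀ B₁ c (q ^ (r ∸ suc k)) B₂ ⟩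
    (a * B₀ + B₁) + (c * q ^ (r ∸ suc k)) * B₁ + c * B₂
      ≈⟨ +-congʳ (+-congˡ exponents) ⟩
    (a * B₀ + B₁) + (a * q ^ suc k) * B₁ + c * B₂
      ≈⟨ solve 6 (λ a B₀ B₁ c e B₂ → (a :* B₀ :+ B₁) :+ (a :* e) :* B₁ :+ c :* B₂ := a :* (B₀ :+ e :* B₁) :+ (B₁ :+ c :* B₂))
               refl a B₀ B₁ c (q ^ suc k) B₂ ⟩
    a * (B₀ + q ^ suc k * B₁) + (B₁ + c * B₂) ∎
    where
    a = q ^ (r ∸ k)
    c = q ^ suc (suc k)
    B₀ = qbinom q r k
    B₁ = qbinom q r (suc k)
    B₂ = qbinom q r (suc (suc k))
    exponents : (c * q ^ (r ∸ suc k)) * B₁ ≈ (a * q ^ suc k) * B₁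
    exponents = begin
      (c * q ^ (r ∸ suc k)) * B₁      ≈⟨ *-congʳ (^-homo-* q (suc (suc k)) (r ∸ suc k)) ⟨
      q ^ (suc (suc k) ℕ.+ (r ∸ suc k)) * B₁ ≈⟨ ^-qbinom-cong q r k (λ k<r → P.trans (P.cong suc (ℕₚ.m+[n∸m]≡n k<r))
                                                (P.sym (P.trans (ℕₚ.+-suc (r ∸ k) k) (P.cong suc (ℕₚ.m∸n+n≡m (ℕₚ.<⇒≤ k<r)))))) ⟩
      q ^ ((r ∸ k) ℕ.+ suc k) * B₁    ≈⟨ *-congʳ (^-homo-* q (r ∸ k) (suc k)) ⟩
      (a * q ^ suc k) * B₁            ∎

module Coefficients {k ℓ} (K : CommutativeRing k ℓ) (β b : CommutativeRing.Carrier K) where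
  open CommutativeRing K hiding (zero)
  open QCalc K
  open QCalc.Coeffs K β b
  open QCalculus K
  open Sum 0# _+_
  open FiniteSums semiring
  open import Algebra.Properties.Semiring.Exp semiring using (_^_; ^-homo-*)
  open import Algebra.Solver.Ring.NaturalCoefficients.Default commutativeSemiring
    using (solve; _:=_; _:+_; _:*_)
  open import Relation.Binary.Reasoning.Setoid setoid

  W≈0 : ∀ m n k → m < k ⊎ n < k → W m n k ≈ 0#
  W≈0 m n       zero    (inj₁ ())
  W≈0 m n       zero    (inj₂ ())
  W≈0 m zero    (suc k) _ = refl
  W≈0 m (suc n) (suc k) (inj₁ (s≤s m≤k)) =
    trans (+-cong (*-zeroʳ-≈ _ (W≈0 m n (suc k) (inj₁ (s≤s m≤k))))
                  (*-zeroˡ-≈ _ (*-zeroʳ-≈ b (reflexive (P.cong (qint β) (ℕₚ.m≤n⇒m∸n≡0 m≤k))))))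
          (+-identityˡ 0#)
  W≈0 m (suc n) (suc k) (inj₂ (s≤s n<k)) =
    trans (+-cong (*-zeroʳ-≈ _ (W≈0 m n (suc k) (inj₂ (ℕₚ.m≤n⇒m≤1+n n<k))))
                  (*-zeroʳ-≈ _ (W≈0 m n k (inj₂ n<k))))
          (+-identityˡ 0#)

  zxCoeff-zero : ∀ n m → zxCoeff n m 0 ≈ β ^ (m ℕ.* n)
  zxCoeff-zero n m = trans (*-identityʳ _) (trans (*-identityʳ _) (trans (*-identityʳ _) (*-identityʳ _)))

  zxCoeff-suc : ∀ n m k → k < m →
    β ^ (m ∸ suc k) * zxCoeff n m (suc k) + b * qint β (m ∸ k) * zxCoeff n m k ≈ zxCoeff (suc n) m (suc k)
  zxCoeff-suc n m k k<m = begin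
    β ^ M * (β ^ (M ℕ.* (n ∸ suc k)) * (b * bᵏ) * B₁ * qbinom β m (suc k) * qfact β (suc k))
      + b * G * (β ^ ((m ∸ k) ℕ.* d) * bᵏ * B₀ * qbinom β m k * qfact β k)
      ≈⟨ solve 12 (λ p p′ b bᵏ B₁ m₁ f₁ G p″ B₀ m₀ f₀ →
                    p :* (p′ :* (b :* bᵏ) :* B₁ :* m₁ :* f₁) :+ b :* G :* (p″ :* bᵏ :* B₀ :* m₀ :* f₀)
                  := p :* (p′ :* B₁) :* (b :* bᵏ) :* (m₁ :* f₁) :+ b :* G :* p″ :* bᵏ :* (B₀ :* (m₀ :* f₀)))
           refl (β ^ M) (β ^ (M ℕ.* (n ∸ suc k))) b bᵏ B₁ (qbinom β m (suc k)) (qfact β (suc k))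
                G (β ^ ((m ∸ k) ℕ.* d)) B₀ (qbinom β m k) (qfact β k) ⟩
    β ^ M * (β ^ (M ℕ.* (n ∸ suc k)) * B₁) * (b * bᵏ) * P + b * G * β ^ ((m ∸ k) ℕ.* d) * bᵏ * (B₀ * Q)
      ≈⟨ +-cong (*-cong (*-congʳ shift-exponent) P≈Q*G) (*-congʳ (*-congʳ (*-congˡ split-exponent))) ⟩
    β ^ (M ℕ.* d) * B₁ * (b * bᵏ) * (Q * G) + b * G * (β ^ d * β ^ (M ℕ.* d)) * bᵏ * (B₀ * Q)
      ≈⟨ solve 8 (λ p B₁ b bᵏ Q G p′ B₀ → p :* B₁ :* (b :* bᵏ) :* (Q :* G) :+ b :* G :* (p′ :* p) :* bᵏ :* (B₀ :* Q)
                 := p :* (b :* bᵏ) :* (p′ :* B₀ :+ B₁) :* (Q :* G))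
           refl (β ^ (M ℕ.* d)) B₁ b bᵏ Q G (β ^ d) B₀ ⟩
    β ^ (M ℕ.* d) * (b * bᵏ) * (β ^ d * B₀ + B₁) * (Q * G)
      ≈⟨ *-cong (*-congˡ (qbinom-pascal′ β n k)) P≈Q*G ⟨
    β ^ (M ℕ.* d) * (b * bᵏ) * qbinom β (suc n) (suc k) * P
      ≈⟨ *-assoc _ _ _ ⟨
    zxCoeff (suc n) m (suc k) ∎
    where
    M = m ∸ suc k
    d = n ∸ k
    G = qint β (m ∸ k)
    bᵏ = b ^ k
    B₀ = qbinom β n k
    B₁ = qbinom β n (suc k)
    Q = qbinom β m k * qfact β k
    P = qbinom β m (suc k) * qfact β (suc k)
    P≈Q*G : P ≈ Q * G
    P≈Q*G = trans (qbinom*qfact≈qfalling β m (suc k)) (*-congʳ (sym (qbinom*qfact≈qfalling β m k)))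
    split-exponent : β ^ ((m ∸ k) ℕ.* d) ≈ β ^ d * β ^ (M ℕ.* d)
    split-exponent = trans (reflexive (P.cong (λ e → β ^ (e ℕ.* d)) (ℕₚ.+-∸-assoc 1 k<m))) (^-homo-* β d (M ℕ.* d))
    shift-exponent : β ^ M * (β ^ (M ℕ.* (n ∸ suc k)) * B₁) ≈ β ^ (M ℕ.* d) * B₁
    shift-exponent = begin
      β ^ M * (β ^ (M ℕ.* (n ∸ suc k)) * B₁)   ≈⟨ *-assoc _ _ _ ⟨
      β ^ M * β ^ (M ℕ.* (n ∸ suc k)) * B₁     ≈⟨ *-congʳ (^-homo-* β M _) ⟨
      β ^ (M ℕ.+ M ℕ.* (n ∸ suc k)) * B₁
        ≈⟨ ^-qbinom-cong β n k (λ k<n → P.trans (P.sym (ℕₚ.*-suc M _)) (P.cong (M ℕ.*_) (P.sym (ℕₚ.+-∸-assoc 1 k<n)))) ⟩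
      β ^ (M ℕ.* d) * B₁                       ∎

  W≈zxCoeff : ∀ m n k → k ≤ m → W m n k ≈ zxCoeff n m k
  W≈zxCoeff m zero    zero    _ = sym (trans (zxCoeff-zero 0 m) (reflexive (P.cong (β ^_) (ℕₚ.*-zeroʳ m))))
  W≈zxCoeff m zero    (suc k) _ = sym (*-zeroˡ-≈ _ (*-zeroˡ-≈ _ (*-zeroʳ-≈ _ refl)))
  W≈zxCoeff m (suc n) zero    _ = begin
    β ^ m * W m n 0          ≈⟨ *-congˡ (trans (W≈zxCoeff m n 0 z≤n) (zxCoeff-zero n m)) ⟩
    β ^ m * β ^ (m ℕ.* n)    ≈⟨ ^-homo-* β m (m ℕ.* n) ⟨
    β ^ (m ℕ.+ m ℕ.* n)      ≈⟨ reflexive (P.cong (β ^_) (ℕₚ.*-suc m n)) ⟨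
    β ^ (m ℕ.* suc n)        ≈⟨ zxCoeff-zero (suc n) m ⟨
    zxCoeff (suc n) m 0      ∎
  W≈zxCoeff m (suc n) (suc k) k<m =
    trans (+-cong (*-congˡ (W≈zxCoeff m n (suc k) k<m)) (*-congˡ (W≈zxCoeff m n k (ℕₚ.<⇒≤ k<m))))
          (zxCoeff-suc n m k k<m)

  U≈0 : ∀ n m s l → n ℕ.* suc s < l ⊎ m ℕ.* suc s < l → U n m (suc s) l ≈ 0#
  U≈0 n m zero    zero    (inj₁ ())
  U≈0 n m zero    zero    (inj₂ ())
  U≈0 n m zero    (suc l) _ = refl
  U≈0 n m (suc s) l beyond =
    sumTo-zero (n ⊓ l) _ (λ k k≤n⊓l → term k (ℕₚ.m≤n⊓o⇒m≤n n l k≤n⊓l) (ℕₚ.m≤n⊓o⇒m≤o n l k≤n⊓l) beyond)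
    where
    term : ∀ k → k ≤ n → k ≤ l → n ℕ.* suc (suc s) < l ⊎ m ℕ.* suc (suc s) < l →
           U n m (suc s) (l ∸ k) * W n (m ℕ.* suc s ∸ (l ∸ k)) k ≈ 0#
    term k k≤n k≤l (inj₁ n[s+2]<l) = *-zeroˡ-≈ _ (U≈0 n m s (l ∸ k) (inj₁ (m+n<o⇒n<o∸m k
      (ℕₚ.≤-<-trans (ℕₚ.+-monoˡ-≤ (n ℕ.* suc s) k≤n) (P.subst (_< l) (ℕₚ.*-suc n (suc s)) n[s+2]<l)))))
    term k k≤n k≤l (inj₂ m[s+2]<l) with m ℕ.* suc s ℕₚ.<? l ∸ k
    ... | yes m[s+1]<l∸k = *-zeroˡ-≈ _ (U≈0 n m s (l ∸ k) (inj₂ m[s+1]<l∸k))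
    ... | no  m[s+1]≮l∸k = *-zeroʳ-≈ _ (W≈0 n _ k (inj₂ (n≤m⇒m<n+o⇒m∸n<o (ℕₚ.≮⇒≥ m[s+1]≮l∸k)
            (P.subst (m ℕ.* suc s <_) (P.sym (ℕₚ.m∸n+n≡m k≤l))
              (ℕₚ.≤-<-trans (ℕₚ.*-monoʳ-≤ m (ℕₚ.n≤1+n (suc s))) m[s+2]<l)))))

  U-convolution : ∀ n m s j → convolution (U n m (suc s)) (λ l → W n (m ℕ.* suc s ∸ l)) j ≈ U n m (suc (suc s)) j
  U-convolution n m s j = begin
    sumTo j (λ l → U n m (suc s) l * W n (m ℕ.* suc s ∸ l) (j ∸ l))
      ≈⟨ sumTo-reverse j _ ⟩
    sumTo j (λ k → U n m (suc s) (j ∸ k) * W n (m ℕ.* suc s ∸ (j ∸ k)) (j ∸ (j ∸ k)))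
      ≈⟨ sumTo-cong j (λ k k≤j → *-congˡ (reflexive (P.cong (W n (m ℕ.* suc s ∸ (j ∸ k))) (ℕₚ.m∸[m∸n]≡n k≤j)))) ⟩
    sumTo j (λ k → U n m (suc s) (j ∸ k) * W n (m ℕ.* suc s ∸ (j ∸ k)) k)
      ≈⟨ sumTo-extend (n ⊓ j) j _ (ℕₚ.m⊓n≤n n j)
           (λ k n⊓j<k k≤j → *-zeroʳ-≈ _ (W≈0 n (m ℕ.* suc s ∸ (j ∸ k)) k (inj₁ (n<k n⊓j<k k≤j)))) ⟩
    U n m (suc (suc s)) j ∎
    where
    n<k : ∀ {k} → n ⊓ j < k → k ≤ j → n < k
    n<k n⊓j<k k≤j with m⊓n<o⇒m<o⊎n<o n⊓j<k
    ... | inj₁ n<k = n<k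
    ... | inj₂ j<k = ⊥-elim (ℕₚ.<⇒≱ j<k k≤j)

  -- z^e (x z) = β^e x z^(e+1) + b [e]_β z^e: the coefficients of its normal form, indexed by the drop in degree.
  xzCoeff : ℕ → ℕ → Carrier
  xzCoeff e zero          = β ^ e
  xzCoeff e (suc zero)    = b * qint β e
  xzCoeff e (suc (suc _)) = 0#

  1<k⇒xzCoeff≈0 : ∀ e {k} → 1 < k → xzCoeff e k ≈ 0#
  1<k⇒xzCoeff≈0 e {suc zero}    (s≤s ())
  1<k⇒xzCoeff≈0 e {suc (suc k)} _ = refl

  V≈0 : ∀ s l → suc s < l → V (suc s) l ≈ 0#
  V≈0 zero    (suc zero)    (s≤s ())
  V≈0 zero    (suc (suc l)) _         = refl
  V≈0 (suc s) (suc l)       (s≤s s<l) =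
    trans (+-cong (*-zeroʳ-≈ _ (V≈0 s (suc l) (ℕₚ.m≤n⇒m≤1+n s<l))) (*-zeroʳ-≈ _ (V≈0 s l s<l)))
          (+-identityˡ 0#)

  V-convolution : ∀ s j → convolution (V (suc s)) (λ l → xzCoeff (suc s ∸ l)) j ≈ V (suc (suc s)) j
  V-convolution s zero    = *-comm _ _
  V-convolution s (suc j) = begin
    sumTo j (λ l → V (suc s) l * xzCoeff (suc s ∸ l) (suc j ∸ l)) + V (suc s) (suc j) * xzCoeff (s ∸ j) (j ∸ j)
      ≈⟨ +-cong (sumTo-single j j _ ℕₚ.≤-refl (λ l l≤j l≢j → *-zeroʳ-≈ _ (1<k⇒xzCoeff≈0 _ (1<[j+1]∸l l≤j l≢j))))
                (*-congˡ (reflexive (P.cong (xzCoeff (s ∸ j)) (ℕₚ.n∸n≡0 j)))) ⟩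
    V (suc s) j * xzCoeff (suc s ∸ j) (suc j ∸ j) + V (suc s) (suc j) * β ^ (s ∸ j)
      ≈⟨ +-congʳ (*-congˡ (reflexive (P.cong (xzCoeff (suc s ∸ j)) (ℕₚ.m+n∸n≡m 1 j)))) ⟩
    V (suc s) j * (b * qint β (suc s ∸ j)) + V (suc s) (suc j) * β ^ (s ∸ j)
      ≈⟨ +-comm _ _ ⟩
    V (suc s) (suc j) * β ^ (s ∸ j) + V (suc s) j * (b * qint β (suc s ∸ j))
      ≈⟨ +-cong (*-comm _ _) (*-comm _ _) ⟩
    V (suc (suc s)) (suc j) ∎
    where
    1<[j+1]∸l : ∀ {l} → l ≤ j → l ≢ j → 1 < suc j ∸ l
    1<[j+1]∸l l≤j l≢j = P.subst (1 <_) (P.sym (ℕₚ.+-∸-assoc 1 l≤j)) (s≤s (ℕₚ.m<n⇒0<n∸m (ℕₚ.≤∧≢⇒< l≤j l≢j)))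

  Θ≈0 : ∀ r n k → n < k ⊎ r < k → Θ r n k ≈ 0#
  Θ≈0 r n k (inj₁ n<k) = *-zeroˡ-≈ _ (*-zeroʳ-≈ _ (r<k⇒qbinom≈0 β n<k))
  Θ≈0 r n k (inj₂ r<k) = *-zeroˡ-≈ _ (*-zeroˡ-≈ _ (*-zeroʳ-≈ _ (r<k⇒qbinom≈0 β r<k)))

  Caux≈0ˡ : ∀ t n c j a l → c ℕ.* n < l → Caux t n j c a l ≈ 0#
  Caux≈0ˡ t n zero    j a (suc l) _    = refl
  Caux≈0ˡ t n (suc c) j a l       cn<l = sumTo-zero l _ term
    where
    term : ∀ k → k ≤ l → Θ (t ℕ.* j ∸ a) n k * Caux t n (suc j) c (a ℕ.+ k) (l ∸ k) ≈ 0#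
    term k _ with n ℕₚ.<? k
    ... | yes n<k = *-zeroˡ-≈ _ (Θ≈0 _ n k (inj₁ n<k))
    ... | no  n≮k = *-zeroʳ-≈ _ (Caux≈0ˡ t n c (suc j) (a ℕ.+ k) (l ∸ k)
                      (m+n<o⇒n<o∸m k (ℕₚ.≤-<-trans (ℕₚ.+-monoˡ-≤ (c ℕ.* n) (ℕₚ.≮⇒≥ n≮k)) cn<l)))

  Caux≈0ʳ : ∀ t n c j a l → a ≤ t ℕ.* j → t ℕ.* j ℕ.+ c ℕ.* t < a ℕ.+ l → Caux t n j c a l ≈ 0#
  Caux≈0ʳ t n zero    j a zero    a≤tj tj<a = ⊥-elim (ℕₚ.<⇒≱ tj<a (ℕₚ.+-monoˡ-≤ 0 a≤tj))
  Caux≈0ʳ t n zero    j a (suc l) _    _    = refl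
  Caux≈0ʳ t n (suc c) j a l       a≤tj beyond = sumTo-zero l _ term
    where
    term : ∀ k → k ≤ l → Θ (t ℕ.* j ∸ a) n k * Caux t n (suc j) c (a ℕ.+ k) (l ∸ k) ≈ 0#
    term k k≤l with t ℕ.* j ∸ a ℕₚ.<? k
    ... | yes tj∸a<k = *-zeroˡ-≈ _ (Θ≈0 _ n k (inj₂ tj∸a<k))
    ... | no  tj∸a≮k = *-zeroʳ-≈ _ (Caux≈0ʳ t n c (suc j) (a ℕ.+ k) (l ∸ k) (a≤tj⇒a+k≤t[j+1] t j a a≤tj (ℕₚ.≮⇒≥ tj∸a≮k))
                         (P.subst₂ _<_ (regroup t j c)
                           (P.trans (P.cong (a ℕ.+_) (P.sym (ℕₚ.m+[n∸m]≡n k≤l))) (P.sym (ℕₚ.+-assoc a k (l ∸ k))))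
                           beyond))
      where
      regroup : ∀ t j c → t ℕ.* j ℕ.+ suc c ℕ.* t ≡ t ℕ.* suc j ℕ.+ c ℕ.* t
      regroup = solve-∀

  𝒞≈0 : ∀ n t s l → s ℕ.* n < l ⊎ t ℕ.* suc s < l → 𝒞 n t (suc s) l ≈ 0#
  𝒞≈0 n t s l (inj₁ sn<l)     = Caux≈0ˡ t n s 1 0 l sn<l
  𝒞≈0 n t s l (inj₂ t[s+1]<l) = Caux≈0ʳ t n s 1 0 l z≤n (P.subst (_< l) (P.sym (t*1+s*t≡t*[s+1] t s)) t[s+1]<l)
    where
    t*1+s*t≡t*[s+1] : ∀ t s → t ℕ.* 1 ℕ.+ s ℕ.* t ≡ t ℕ.* suc s
    t*1+s*t≡t*[s+1] = solve-∀

  E≈0 : ∀ n i k → n < i ℕ.+ k → E n i k ≈ 0#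
  E≈0 zero    zero    (suc k) _       = refl
  E≈0 zero    (suc i) k       _       = refl
  E≈0 (suc n) zero    (suc k) (s≤s n<k) =
    trans (+-cong (+-identityʳ _) (*-zeroʳ-≈ _ (E≈0 n zero (suc (suc k)) (ℕₚ.<-≤-trans n<k (ℕₚ.m≤n⇒m≤1+n (ℕₚ.n≤1+n k))))))
          (trans (+-congʳ (E≈0 n zero k n<k)) (+-identityʳ _))
  E≈0 (suc n) (suc i) zero    (s≤s n<i) =
    trans (+-cong (+-identityˡ _) (*-zeroʳ-≈ _ (E≈0 n (suc i) 1 (ℕₚ.<-≤-trans n<i (ℕₚ.+-mono-≤ (ℕₚ.n≤1+n i) z≤n)))))
          (trans (+-congʳ (*-zeroʳ-≈ _ (E≈0 n i 0 n<i))) (+-identityʳ _))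
  E≈0 (suc n) (suc i) (suc k) (s≤s n<i+k+1) =
    trans (+-cong (+-cong (E≈0 n (suc i) k (P.subst (n <_) (ℕₚ.+-suc i k) n<i+k+1))
                          (*-zeroʳ-≈ _ (E≈0 n i (suc k) n<i+k+1)))
                  (*-zeroʳ-≈ _ (E≈0 n (suc i) (suc (suc k)) (ℕₚ.<-≤-trans n<i+k+1 (ℕₚ.+-mono-≤ (ℕₚ.n≤1+n i) (ℕₚ.n≤1+n (suc k)))))))
          (trans (+-identityʳ _) (+-identityʳ _))

  E[k-1] : ℕ → ℕ → ℕ → Carrier
  E[k-1] n i zero    = 0#
  E[k-1] n i (suc k) = E n i k

  βᵏE[i-1] : ℕ → ℕ → ℕ → Carrier
  βᵏE[i-1] n zero    k = 0#
  βᵏE[i-1] n (suc i) k = β ^ k * E n i k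

  E-suc : ∀ n i k → E (suc n) i k ≈ E[k-1] n i k + βᵏE[i-1] n i k + b * qint β (suc k) * E n i (suc k)
  E-suc n zero    zero    = refl
  E-suc n zero    (suc k) = refl
  E-suc n (suc i) zero    = refl
  E-suc n (suc i) (suc k) = refl

module Commuting {a ℓ} (R : Semiring a ℓ) where
  open Semiring R hiding (zero)
  open Sum 0# _+_
  open FiniteSums R
  open import Algebra.Properties.Semiring.Exp R using (_^_; ^-congˡ; ^-assocʳ)
  open import Algebra.Properties.Semiring.Mult R using (_×_)
  open import Relation.Binary.Reasoning.Setoid setoid
  open import Data.Nat.Combinatorics using (_C_)
  import Algebra.Properties.Semiring.Binomial R as Binomial

  ^-sucʳ : ∀ u n → u ^ suc n ≈ u ^ n * u
  ^-sucʳ u zero    = trans (*-identityʳ u) (sym (*-identityˡ u))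
  ^-sucʳ u (suc n) = trans (*-congˡ (^-sucʳ u n)) (sym (*-assoc _ _ _))

  ^-commˡ : ∀ {u v} → u * v ≈ v * u → ∀ n → u ^ n * v ≈ v * u ^ n
  ^-commˡ {u} {v} uv≈vu zero    = trans (*-identityˡ v) (sym (*-identityʳ v))
  ^-commˡ {u} {v} uv≈vu (suc n) = begin
    u * u ^ n * v   ≈⟨ *-assoc _ _ _ ⟩
    u * (u ^ n * v) ≈⟨ *-congˡ (^-commˡ uv≈vu n) ⟩
    u * (v * u ^ n) ≈⟨ *-assoc _ _ _ ⟨
    u * v * u ^ n   ≈⟨ *-congʳ uv≈vu ⟩
    v * u * u ^ n   ≈⟨ *-assoc _ _ _ ⟩
    v * (u * u ^ n) ∎

  ^-comm : ∀ {u v} → u * v ≈ v * u → ∀ m n → u ^ m * v ^ n ≈ v ^ n * u ^ m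
  ^-comm uv≈vu m n = sym (^-commˡ (sym (^-commˡ uv≈vu m)) n)

  *-commutes : ∀ {u v w} → u * v ≈ v * u → u * w ≈ w * u → u * (v * w) ≈ v * w * u
  *-commutes {u} {v} {w} uv≈vu uw≈wu = begin
    u * (v * w) ≈⟨ *-assoc _ _ _ ⟨
    u * v * w   ≈⟨ *-congʳ uv≈vu ⟩
    v * u * w   ≈⟨ *-assoc _ _ _ ⟩
    v * (u * w) ≈⟨ *-congˡ uw≈wu ⟩
    v * (w * u) ≈⟨ *-assoc _ _ _ ⟨
    v * w * u   ∎

  module _ {u v : Carrier} (uv≈vu : u * v ≈ v * u) where

    ^-distrib-* : ∀ s → (u * v) ^ s ≈ u ^ s * v ^ s
    ^-distrib-* zero    = sym (*-identityˡ 1#)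
    ^-distrib-* (suc s) = begin
      u * v * (u * v) ^ s       ≈⟨ *-congˡ (^-distrib-* s) ⟩
      u * v * (u ^ s * v ^ s)   ≈⟨ *-assoc _ _ _ ⟩
      u * (v * (u ^ s * v ^ s)) ≈⟨ *-congˡ (*-assoc _ _ _) ⟨
      u * (v * u ^ s * v ^ s)   ≈⟨ *-congˡ (*-congʳ (^-commˡ uv≈vu s)) ⟨
      u * (u ^ s * v * v ^ s)   ≈⟨ *-congˡ (*-assoc _ _ _) ⟩
      u * (u ^ s * (v * v ^ s)) ≈⟨ *-assoc _ _ _ ⟨
      u * u ^ s * (v * v ^ s)   ∎

    binomial-theorem : ∀ n → (u + v) ^ n ≈ sumTo n (λ k → (n C k) × (u ^ (n ∸ k) * v ^ k))
    binomial-theorem n = begin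
      (u + v) ^ n                                       ≈⟨ ^-congˡ n (+-comm u v) ⟩
      (v + u) ^ n                                       ≈⟨ Binomial.theorem v u (sym uv≈vu) n ⟩
      ∑[ k ≤ n ] ((n C toℕ k) × (v ^ toℕ k * u ^ (n ∸ toℕ k))) ≈⟨ sumTo≈∑ n _ ⟨
      sumTo n (λ k → (n C k) × (v ^ k * u ^ (n ∸ k)))  ≈⟨ sumTo-cong n (λ k _ → ×-congʳ (n C k) (sym (^-comm uv≈vu (n ∸ k) k))) ⟩
      sumTo n (λ k → (n C k) × (u ^ (n ∸ k) * v ^ k))  ∎
      where
      open import Algebra.Properties.Semiring.Sum R using (sum⁺-syntax)
      open import Algebra.Properties.Monoid.Mult +-monoid using (×-congʳ)


  [u^n*v^m]^s : ∀ {u v} → u * v ≈ v * u → ∀ n m s → (u ^ n * v ^ m) ^ s ≈ u ^ (n ℕ.* s) * v ^ (m ℕ.* s)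
  [u^n*v^m]^s {u} {v} uv≈vu n m s =
    trans (^-distrib-* (^-comm uv≈vu n m) s) (*-cong (^-assocʳ u n s) (^-assocʳ v m s))

module NormalOrdering {c ℓ c′ ℓ′} (S : Setting c ℓ c′ ℓ′) where
  open Setting S
  private module K = CommutativeRing K
  open QCalc K using (qint)
  open QCalculus K using (qint-suc)
  open Coefficients K β b
    using (W≈0; W≈zxCoeff; U≈0; U-convolution; xzCoeff; 1<k⇒xzCoeff≈0; V≈0; V-convolution;
           Θ≈0; Caux≈0ˡ; 𝒞≈0; E≈0; E[k-1]; βᵏE[i-1]; E-suc)
  open FiniteSums semiring
  open Commuting semiring
  open Sum K.0# K._+_ using () renaming (sumTo to sumToᴷ)
  private module ΣK = FiniteSums K.semiring
  open import Algebra.Properties.Semiring.Exp semiring using (^-homo-*; ^-assocʳ; ^-congˡ)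
  open import Algebra.Properties.Semiring.Mult semiring using (_×_)
  open import Algebra.Properties.Semiring.Exp K.semiring using () renaming (_^_ to _^ᴷ_)
  open RingMorphisms.IsRingHomomorphism ι-hom
    using () renaming (⟦⟧-cong to ι-cong; +-homo to ι-+; *-homo to ι-*; 0#-homo to ι-0; 1#-homo to ι-1)
  open import Algebra.Solver.Ring.NaturalCoefficients.Default K.commutativeSemiring
    using (solve; _:=_; _:+_; _:*_)
  open import Algebra.Properties.Group +-group using (//-rightDividesˡ)
  open import Relation.Binary.Reasoning.Setoid setoid

  infixl 7 _*ᴷ_
  infixl 6 _+ᴷ_
  _*ᴷ_ = K._*_
  _+ᴷ_ = K._+_

  ≈-from-difference : ∀ {u v w} → u - v ≈ w → u ≈ w + v
  ≈-from-difference {u} {v} u-v≈w = trans (sym (//-rightDividesˡ v u)) (+-congʳ u-v≈w)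

  xy≈yx : x * y ≈ y * x
  xy≈yx = trans (≈-from-difference rel-xy) (+-identityˡ _)

  yz≈zy : y * z ≈ z * y
  yz≈zy = trans (≈-from-difference rel-yz) (+-identityˡ _)

  zx≈βxz+b : z * x ≈ ι β * x * z + ι b
  zx≈βxz+b = trans (≈-from-difference rel-zx) (+-comm _ _)

  mono : ℕ → K.Carrier → ℕ → Carrier
  mono i a k = x ^ i * ι a * z ^ k

  mono-cong : ∀ {i i′ a a′ k k′} → i ≡ i′ → a K.≈ a′ → k ≡ k′ → mono i a k ≈ mono i′ a′ k′
  mono-cong P.refl a≈a′ P.refl = *-congʳ (*-congˡ (ι-cong a≈a′))

  ι≈0 : ∀ {a} → a K.≈ K.0# → ι a ≈ 0#
  ι≈0 a≈0 = trans (ι-cong a≈0) ι-0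

  mono≈0 : ∀ i k {a} → a K.≈ K.0# → mono i a k ≈ 0#
  mono≈0 i k a≈0 = *-zeroˡ-≈ _ (*-zeroʳ-≈ _ (ι≈0 a≈0))

  mono-+ : ∀ i a a′ k → mono i (a +ᴷ a′) k ≈ mono i a k + mono i a′ k
  mono-+ i a a′ k = trans (*-congʳ (trans (*-congˡ (ι-+ a a′)) (distribˡ _ _ _))) (distribʳ _ _ _)

  mono-sumTo : ∀ i j k (f : ℕ → K.Carrier) → sumTo j (λ l → mono i (f l) k) ≈ mono i (sumToᴷ j f) k
  mono-sumTo i zero    k f = refl
  mono-sumTo i (suc j) k f = trans (+-congʳ (mono-sumTo i j k f)) (sym (mono-+ i _ _ k))

  ι-*-ι : ∀ u a a′ → u * ι a * ι a′ ≈ u * ι (a *ᴷ a′)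
  ι-*-ι u a a′ = trans (*-assoc _ _ _) (*-congˡ (sym (ι-* a a′)))

  mono-*-ι-z^ : ∀ i a k a′ e → mono i a k * (ι a′ * z ^ e) ≈ mono i (a *ᴷ a′) (k ℕ.+ e)
  mono-*-ι-z^ i a k a′ e = begin
    x ^ i * ι a * z ^ k * (ι a′ * z ^ e)   ≈⟨ *-assoc _ _ _ ⟨
    x ^ i * ι a * z ^ k * ι a′ * z ^ e     ≈⟨ *-congʳ (*-assoc _ _ _) ⟩
    x ^ i * ι a * (z ^ k * ι a′) * z ^ e   ≈⟨ *-congʳ (*-congˡ (ι-central a′ _)) ⟨
    x ^ i * ι a * (ι a′ * z ^ k) * z ^ e   ≈⟨ *-congʳ (*-assoc _ _ _) ⟨
    x ^ i * ι a * ι a′ * z ^ k * z ^ e     ≈⟨ *-congʳ (*-congʳ (ι-*-ι _ a a′)) ⟩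
    x ^ i * ι (a *ᴷ a′) * z ^ k * z ^ e    ≈⟨ *-assoc _ _ _ ⟩
    x ^ i * ι (a *ᴷ a′) * (z ^ k * z ^ e)  ≈⟨ *-congˡ (^-homo-* z k e) ⟨
    mono i (a *ᴷ a′) (k ℕ.+ e)             ∎

  x^-ι-*-mono : ∀ p a′ i a k → x ^ p * ι a′ * mono i a k ≈ mono (p ℕ.+ i) (a′ *ᴷ a) k
  x^-ι-*-mono p a′ i a k = begin
    x ^ p * ι a′ * (x ^ i * ι a * z ^ k)   ≈⟨ *-assoc _ _ _ ⟨
    x ^ p * ι a′ * (x ^ i * ι a) * z ^ k   ≈⟨ *-congʳ (*-assoc _ _ _) ⟨
    x ^ p * ι a′ * x ^ i * ι a * z ^ k     ≈⟨ *-congʳ (*-congʳ (*-assoc _ _ _)) ⟩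
    x ^ p * (ι a′ * x ^ i) * ι a * z ^ k   ≈⟨ *-congʳ (*-congʳ (*-congˡ (ι-central a′ _))) ⟩
    x ^ p * (x ^ i * ι a′) * ι a * z ^ k   ≈⟨ *-congʳ (*-congʳ (*-assoc _ _ _)) ⟨
    x ^ p * x ^ i * ι a′ * ι a * z ^ k     ≈⟨ *-congʳ (ι-*-ι _ a′ a) ⟩
    x ^ p * x ^ i * ι (a′ *ᴷ a) * z ^ k    ≈⟨ *-congʳ (*-congʳ (^-homo-* x p i)) ⟨
    mono (p ℕ.+ i) (a′ *ᴷ a) k             ∎

  ι-*-x^ : ∀ a i → ι a * x ^ i ≈ mono i a 0
  ι-*-x^ a i = trans (ι-central a _) (sym (*-identityʳ _))

  ι-*-x-*-mono : ∀ a′ i a k → ι a′ * x * mono i a k ≈ mono (suc i) (a′ *ᴷ a) k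
  ι-*-x-*-mono a′ i a k =
    trans (*-congʳ (trans (ι-central a′ x) (*-congʳ (sym (*-identityʳ x))))) (x^-ι-*-mono 1 a′ i a k)

  mono-predˣ : ∀ j a k → (j ≡ 0 → a K.≈ K.0#) → mono (suc (j ∸ 1)) a k ≈ mono j a k
  mono-predˣ zero    a k a≈0 = trans (mono≈0 1 k (a≈0 P.refl)) (sym (mono≈0 0 k (a≈0 P.refl)))
  mono-predˣ (suc j) a k _   = refl

  mono-predᶻ : ∀ i a j → (j ≡ 0 → a K.≈ K.0#) → mono i a (suc (j ∸ 1)) ≈ mono i a j
  mono-predᶻ i a zero    a≈0 = trans (mono≈0 i 1 (a≈0 P.refl)) (sym (mono≈0 i 0 (a≈0 P.refl)))
  mono-predᶻ i a (suc j) _   = refl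

  β*b[j]+b≈b[j+1] : ∀ j → β *ᴷ (b *ᴷ qint β j) +ᴷ b K.≈ b *ᴷ qint β (suc j)
  β*b[j]+b≈b[j+1] j = K.sym (K.trans (K.*-congˡ (qint-suc β j))
    (K.trans (solve 4 (λ β b q o → b :* (o :+ β :* q) := β :* (b :* q) :+ b :* o) K.refl β b (qint β j) K.1#)
             (K.+-congˡ (K.*-identityʳ b))))

  z*x^j : ∀ j → z * x ^ j ≈ mono j (β ^ᴷ j) 1 + mono (j ∸ 1) (b *ᴷ qint β j) 0
  z*x^j zero    = sym (trans (+-cong (trans (*-congʳ (trans (*-congˡ ι-1) (*-identityʳ 1#))) (*-identityˡ _))
                                    (mono≈0 0 0 (K.zeroʳ b)))
                             (+-identityʳ _))
  z*x^j (suc j) = begin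
    z * (x * x ^ j)                                          ≈⟨ *-assoc _ _ _ ⟨
    z * x * x ^ j                                            ≈⟨ *-congʳ zx≈βxz+b ⟩
    (ι β * x * z + ι b) * x ^ j                              ≈⟨ distribʳ _ _ _ ⟩
    ι β * x * z * x ^ j + ι b * x ^ j                        ≈⟨ +-congʳ (*-assoc _ _ _) ⟩
    ι β * x * (z * x ^ j) + ι b * x ^ j                      ≈⟨ +-congʳ (*-congˡ (z*x^j j)) ⟩
    ι β * x * (mono j (β ^ᴷ j) 1 + mono (j ∸ 1) (b *ᴷ qint β j) 0) + ι b * x ^ j
      ≈⟨ trans (+-congʳ (distribˡ _ _ _)) (+-assoc _ _ _) ⟩
    ι β * x * mono j (β ^ᴷ j) 1 + (ι β * x * mono (j ∸ 1) (b *ᴷ qint β j) 0 + ι b * x ^ j)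
      ≈⟨ +-cong (ι-*-x-*-mono β j _ 1) (+-cong (ι-*-x-*-mono β (j ∸ 1) _ 0) (ι-*-x^ b j)) ⟩
    mono (suc j) (β *ᴷ β ^ᴷ j) 1 + (mono (suc (j ∸ 1)) (β *ᴷ (b *ᴷ qint β j)) 0 + mono j b 0)
      ≈⟨ +-congˡ (+-congʳ (mono-predˣ j _ 0 λ { P.refl → ΣK.*-zeroʳ-≈ β (K.zeroʳ b) })) ⟩
    mono (suc j) (β ^ᴷ suc j) 1 + (mono j (β *ᴷ (b *ᴷ qint β j)) 0 + mono j b 0)
      ≈⟨ +-congˡ (trans (sym (mono-+ j _ _ 0)) (*-congʳ (*-congˡ (ι-cong (β*b[j]+b≈b[j+1] j))))) ⟩
    mono (suc j) (β ^ᴷ suc j) 1 + mono j (b *ᴷ qint β (suc j)) 0 ∎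

  z*mono : ∀ i a k → z * mono i a k ≈ mono i (β ^ᴷ i *ᴷ a) (suc k) + mono (i ∸ 1) (b *ᴷ qint β i *ᴷ a) k
  z*mono i a k = begin
    z * (x ^ i * ι a * z ^ k)   ≈⟨ *-congˡ (*-assoc _ _ _) ⟩
    z * (x ^ i * (ι a * z ^ k)) ≈⟨ *-assoc _ _ _ ⟨
    z * x ^ i * (ι a * z ^ k)   ≈⟨ *-congʳ (z*x^j i) ⟩
    (mono i (β ^ᴷ i) 1 + mono (i ∸ 1) (b *ᴷ qint β i) 0) * (ι a * z ^ k)
      ≈⟨ distribʳ _ _ _ ⟩
    mono i (β ^ᴷ i) 1 * (ι a * z ^ k) + mono (i ∸ 1) (b *ᴷ qint β i) 0 * (ι a * z ^ k)
      ≈⟨ +-cong (mono-*-ι-z^ i _ 1 a k) (mono-*-ι-z^ (i ∸ 1) _ 0 a k) ⟩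
    mono i (β ^ᴷ i *ᴷ a) (suc k) + mono (i ∸ 1) (b *ᴷ qint β i *ᴷ a) k ∎

  z^j*x : ∀ j → z ^ j * x ≈ mono 1 (β ^ᴷ j) j + mono 0 (b *ᴷ qint β j) (j ∸ 1)
  z^j*x zero    = trans (*-identityˡ x) (sym (trans (+-cong x≈ (mono≈0 0 0 (K.zeroʳ b))) (+-identityʳ x)))
    where x≈ = trans (*-identityʳ _) (trans (*-congˡ ι-1) (trans (*-identityʳ _) (*-identityʳ x)))
  z^j*x (suc j) = begin
    z * z ^ j * x                                                  ≈⟨ *-assoc _ _ _ ⟩
    z * (z ^ j * x)                                                ≈⟨ *-congˡ (z^j*x j) ⟩
    z * (mono 1 (β ^ᴷ j) j + mono 0 (b *ᴷ qint β j) (j ∸ 1))     ≈⟨ distribˡ _ _ _ ⟩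
    z * mono 1 (β ^ᴷ j) j + z * mono 0 (b *ᴷ qint β j) (j ∸ 1)   ≈⟨ +-cong (z*mono 1 _ j) (z*mono 0 _ (j ∸ 1)) ⟩
    (mono 1 (β ^ᴷ 1 *ᴷ β ^ᴷ j) (suc j) + mono 0 (b *ᴷ qint β 1 *ᴷ β ^ᴷ j) j)
      + (mono 0 (K.1# *ᴷ (b *ᴷ qint β j)) (suc (j ∸ 1)) + mono 0 (b *ᴷ K.0# *ᴷ (b *ᴷ qint β j)) (j ∸ 1))
      ≈⟨ +-cong (+-congʳ (*-congʳ (*-congˡ (ι-cong (K.*-congʳ (K.*-identityʳ β))))))
                (trans (+-cong (mono-predᶻ 0 _ j λ { P.refl → K.trans (K.*-identityˡ _) (K.zeroʳ b) })
                               (mono≈0 0 (j ∸ 1) (ΣK.*-zeroˡ-≈ _ (K.zeroʳ b))))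
                       (+-identityʳ _)) ⟩
    mono 1 (β ^ᴷ suc j) (suc j) + mono 0 (b *ᴷ qint β 1 *ᴷ β ^ᴷ j) j + mono 0 (K.1# *ᴷ (b *ᴷ qint β j)) j
      ≈⟨ trans (+-assoc _ _ _) (+-congˡ (trans (sym (mono-+ 0 _ _ j)) (*-congʳ (*-congˡ (ι-cong b[j+1]))))) ⟩
    mono 1 (β ^ᴷ suc j) (suc j) + mono 0 (b *ᴷ qint β (suc j)) j ∎
    where
    b[j+1] : b *ᴷ qint β 1 *ᴷ β ^ᴷ j +ᴷ K.1# *ᴷ (b *ᴷ qint β j) K.≈ b *ᴷ qint β (suc j)
    b[j+1] = K.trans (K.+-cong (K.*-congʳ (K.trans (K.*-congˡ (K.+-identityˡ K.1#)) (K.*-identityʳ b))) (K.*-identityˡ _))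
                     (solve 3 (λ b p q → b :* p :+ b :* q := b :* (q :+ p)) K.refl b (β ^ᴷ j) (qint β j))

  z^n*x^m≈∑W : ∀ m n → z ^ n * x ^ m ≈ sumTo n (λ k → mono (m ∸ k) (W m n k) (n ∸ k))
  z^n*x^m≈∑W m zero    = trans (*-identityˡ _) (sym (trans (*-identityʳ _) (trans (*-congˡ ι-1) (*-identityʳ _))))
  z^n*x^m≈∑W m (suc n) = begin
    z * z ^ n * x ^ m                       ≈⟨ *-assoc _ _ _ ⟩
    z * (z ^ n * x ^ m)                     ≈⟨ *-congˡ (z^n*x^m≈∑W m n) ⟩
    z * sumTo n T                           ≈⟨ *-distribˡ-sumTo n z T ⟩
    sumTo n (λ k → z * T k)                 ≈⟨ sumTo-cong n z*T ⟩
    sumTo n (λ k → P k + Q k)               ≈⟨ sumTo-+ n P Q ⟩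
    sumTo n P + sumTo n Q
      ≈⟨ sumTo-+-shift n P Q (mono≈0 (m ∸ suc n) (n ∸ n) (ΣK.*-zeroʳ-≈ _ (W≈0 m n (suc n) (inj₂ (ℕₚ.n<1+n n))))) ⟩
    P 0 + sumTo n (λ k → P (suc k) + Q k)   ≈⟨ +-congˡ (sumTo-cong n (λ k _ → sym (mono-+ (m ∸ suc k) _ _ (n ∸ k)))) ⟩
    P 0 + sumTo n (λ k → T′ (suc k))        ≈⟨ sumTo-head n T′ ⟨
    sumTo (suc n) T′                        ∎
    where
    T T′ P Q : ℕ → Carrier
    T  k = mono (m ∸ k) (W m n k) (n ∸ k)
    T′ k = mono (m ∸ k) (W m (suc n) k) (suc n ∸ k)
    P  k = mono (m ∸ k) (β ^ᴷ (m ∸ k) *ᴷ W m n k) (suc n ∸ k)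
    Q  k = mono (m ∸ suc k) (b *ᴷ qint β (m ∸ k) *ᴷ W m n k) (n ∸ k)
    z*T : ∀ k → k ≤ n → z * T k ≈ P k + Q k
    z*T k k≤n = trans (z*mono (m ∸ k) _ (n ∸ k))
      (reflexive (P.cong₂ (λ e d → mono (m ∸ k) (β ^ᴷ (m ∸ k) *ᴷ W m n k) e + mono d (b *ᴷ qint β (m ∸ k) *ᴷ W m n k) (n ∸ k))
        (P.sym (ℕₚ.+-∸-assoc 1 k≤n)) (P.trans (ℕₚ.∸-+-assoc m k 1) (P.cong (m ∸_) (ℕₚ.+-comm k 1)))))

  W-term≈0 : ∀ m n k → m ⊓ n < k → mono (m ∸ k) (W m n k) (n ∸ k) ≈ 0#
  W-term≈0 m n k m⊓n<k = mono≈0 (m ∸ k) (n ∸ k) (W≈0 m n k (m⊓n<o⇒m<o⊎n<o m⊓n<k))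

  z^n*x^m≈∑W⊓ : ∀ m n → z ^ n * x ^ m ≈ sumTo (m ⊓ n) (λ k → mono (m ∸ k) (W m n k) (n ∸ k))
  z^n*x^m≈∑W⊓ m n = trans (z^n*x^m≈∑W m n)
    (sumTo-resize (m ⊓ n) n (m ⊓ n) _ (ℕₚ.m⊓n≤n m n) ℕₚ.≤-refl (W-term≈0 m n))

  z^n*x^m≈∑Wᵐ : ∀ m n → z ^ n * x ^ m ≈ sumTo m (λ k → mono (m ∸ k) (W m n k) (n ∸ k))
  z^n*x^m≈∑Wᵐ m n = trans (z^n*x^m≈∑W m n)
    (sumTo-resize (m ⊓ n) n m _ (ℕₚ.m⊓n≤n m n) (ℕₚ.m⊓n≤m m n) (W-term≈0 m n))

  z^n*x^m≈∑zxCoeff : ∀ m n → z ^ n * x ^ m ≈ sumTo (m ⊓ n) (λ k → mono (m ∸ k) (zxCoeff n m k) (n ∸ k))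
  z^n*x^m≈∑zxCoeff m n = trans (z^n*x^m≈∑W⊓ m n)
    (sumTo-cong (m ⊓ n) (λ k k≤m⊓n → *-congʳ (*-congˡ (ι-cong (W≈zxCoeff m n k (ℕₚ.m≤n⊓o⇒m≤n m n k≤m⊓n))))))

  mono≈ι*x^*z^ : ∀ i a k → mono i a k ≈ ι a * x ^ i * z ^ k
  mono≈ι*x^*z^ i a k = *-congʳ (sym (ι-central a _))

  z^n*x^m≈∑ι[zxCoeff] : ∀ m n → z ^ n * x ^ m ≈ sumTo (m ⊓ n) (λ k → ι (zxCoeff n m k) * x ^ (m ∸ k) * z ^ (n ∸ k))
  z^n*x^m≈∑ι[zxCoeff] m n = trans (z^n*x^m≈∑zxCoeff m n) (sumTo-cong (m ⊓ n) (λ k _ → mono≈ι*x^*z^ (m ∸ k) (zxCoeff n m k) (n ∸ k)))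

  z^r*x^n≈∑Θ : ∀ r n → z ^ r * x ^ n ≈ sumTo (r ⊓ n) (λ k → ι (Θ r n k) * x ^ (n ∸ k) * z ^ (r ∸ k))
  z^r*x^n≈∑Θ r n = P.subst (λ e → z ^ r * x ^ n ≈ sumTo e (λ k → ι (Θ r n k) * x ^ (n ∸ k) * z ^ (r ∸ k)))
                             (ℕₚ.⊓-comm n r) (z^n*x^m≈∑ι[zxCoeff] n r)

  ∑mono*≈∑convolution : ∀ A B D N M R (p : ℕ → K.Carrier) (q : ℕ → ℕ → K.Carrier) (Y : Carrier) →
    N ≤ A → N ≤ B → N ℕ.+ M ≤ R →
    (∀ l → N < l → p l K.≈ K.0#) → (∀ l k → M < k → q l k K.≈ K.0#) →
    (∀ l → l ≤ N → z ^ (B ∸ l) * Y ≈ sumTo M (λ k → mono (M ∸ k) (q l k) (B ∸ l ℕ.+ D ∸ k))) →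
    sumTo N (λ l → mono (A ∸ l) (p l) (B ∸ l)) * Y
      ≈ sumTo R (λ j → mono (A ℕ.+ M ∸ j) (ΣK.convolution p q j) (B ℕ.+ D ∸ j))
  ∑mono*≈∑convolution A B D N M R p q Y N≤A N≤B N+M≤R p≈0 q≈0 z^*Y≈ = begin
    sumTo N (λ l → mono (A ∸ l) (p l) (B ∸ l)) * Y
      ≈⟨ *-distribʳ-sumTo N Y _ ⟩
    sumTo N (λ l → mono (A ∸ l) (p l) (B ∸ l) * Y)
      ≈⟨ sumTo-cong N row ⟩
    sumTo N (λ l → sumTo M (term l))
      ≈⟨ sumTo-rectangle N M term (λ l k N<l → term≈0 l k (ΣK.*-zeroˡ-≈ _ (p≈0 l N<l)))
                                  (λ l k M<k → term≈0 l k (ΣK.*-zeroʳ-≈ _ (q≈0 l k M<k))) ⟩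
    sumTo (N ℕ.+ M) (λ j → sumTo j (λ l → term l (j ∸ l)))
      ≈⟨ sumTo-cong (N ℕ.+ M) (λ j _ → trans (sumTo-cong j (λ l l≤j →
             mono-cong (P.cong (A ℕ.+ M ∸_) (ℕₚ.m+[n∸m]≡n l≤j)) K.refl (P.cong (B ℕ.+ D ∸_) (ℕₚ.m+[n∸m]≡n l≤j))))
                                              (mono-sumTo (A ℕ.+ M ∸ j) j (B ℕ.+ D ∸ j) _)) ⟩
    sumTo (N ℕ.+ M) F
      ≈⟨ sumTo-extend (N ℕ.+ M) R F N+M≤R
           (λ j N+M<j _ → mono≈0 (A ℕ.+ M ∸ j) (B ℕ.+ D ∸ j) (ΣK.convolution≈0 N M p q p≈0 q≈0 j N+M<j)) ⟨
    sumTo R F ∎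
    where
    term : ℕ → ℕ → Carrier
    term l k = mono (A ℕ.+ M ∸ (l ℕ.+ k)) (p l *ᴷ q l k) (B ℕ.+ D ∸ (l ℕ.+ k))
    term≈0 : ∀ l k → p l *ᴷ q l k K.≈ K.0# → term l k ≈ 0#
    term≈0 l k = mono≈0 (A ℕ.+ M ∸ (l ℕ.+ k)) (B ℕ.+ D ∸ (l ℕ.+ k))
    F : ℕ → Carrier
    F j = mono (A ℕ.+ M ∸ j) (ΣK.convolution p q j) (B ℕ.+ D ∸ j)
    row : ∀ l → l ≤ N → mono (A ∸ l) (p l) (B ∸ l) * Y ≈ sumTo M (term l)
    row l l≤N = begin
      x ^ (A ∸ l) * ι (p l) * z ^ (B ∸ l) * Y
        ≈⟨ trans (*-assoc _ _ _) (*-congˡ (z^*Y≈ l l≤N)) ⟩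
      x ^ (A ∸ l) * ι (p l) * sumTo M (λ k → mono (M ∸ k) (q l k) (B ∸ l ℕ.+ D ∸ k))
        ≈⟨ *-distribˡ-sumTo M _ _ ⟩
      sumTo M (λ k → x ^ (A ∸ l) * ι (p l) * mono (M ∸ k) (q l k) (B ∸ l ℕ.+ D ∸ k))
        ≈⟨ sumTo-cong M (λ k k≤M → trans (x^-ι-*-mono (A ∸ l) (p l) (M ∸ k) (q l k) (B ∸ l ℕ.+ D ∸ k))
             (reflexive (P.cong₂ (λ i e → mono i (p l *ᴷ q l k) e) ([m∸n]+[o∸p]≡m+o∸[n+p] l≤A k≤M) (zs k)))) ⟩
      sumTo M (term l) ∎
      where
      l≤A = ℕₚ.≤-trans l≤N N≤A
      zs : ∀ k → B ∸ l ℕ.+ D ∸ k ≡ B ℕ.+ D ∸ (l ℕ.+ k)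
      zs k = P.trans (P.cong (_∸ k) (P.sym (ℕₚ.+-∸-comm D (ℕₚ.≤-trans l≤N N≤B)))) (ℕₚ.∸-+-assoc (B ℕ.+ D) l k)

  ∑mono*z^ : ∀ M C R D (q : ℕ → K.Carrier) → (∀ k → R < k → q k K.≈ K.0#) →
    sumTo M (λ k → mono (C ∸ k) (q k) (R ∸ k)) * z ^ D ≈ sumTo M (λ k → mono (C ∸ k) (q k) (R ℕ.+ D ∸ k))
  ∑mono*z^ M C R D q q≈0 = trans (*-distribʳ-sumTo M _ _) (sumTo-cong M (λ k _ → term k))
    where
    term : ∀ k → mono (C ∸ k) (q k) (R ∸ k) * z ^ D ≈ mono (C ∸ k) (q k) (R ℕ.+ D ∸ k)
    term k with R ℕₚ.<? k
    ... | yes R<k = trans (*-zeroˡ-≈ _ (mono≈0 (C ∸ k) (R ∸ k) (q≈0 k R<k)))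
                          (sym (mono≈0 (C ∸ k) (R ℕ.+ D ∸ k) (q≈0 k R<k)))
    ... | no  R≮k = begin
      x ^ (C ∸ k) * ι (q k) * z ^ (R ∸ k) * z ^ D   ≈⟨ *-assoc _ _ _ ⟩
      x ^ (C ∸ k) * ι (q k) * (z ^ (R ∸ k) * z ^ D) ≈⟨ *-congˡ (^-homo-* z (R ∸ k) D) ⟨
      x ^ (C ∸ k) * ι (q k) * z ^ (R ∸ k ℕ.+ D)     ≈⟨ mono-cong {i = C ∸ k} P.refl K.refl (P.sym (ℕₚ.+-∸-comm D (ℕₚ.≮⇒≥ R≮k))) ⟩
      mono (C ∸ k) (q k) (R ℕ.+ D ∸ k)             ∎

  [x^n*z^m]^[s+1]≈∑U : ∀ n m s → (x ^ n * z ^ m) ^ suc s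
    ≈ sumTo ((n ℕ.* suc s) ⊓ (m ℕ.* suc s)) (λ l → mono (n ℕ.* suc s ∸ l) (U n m (suc s) l) (m ℕ.* suc s ∸ l))
  [x^n*z^m]^[s+1]≈∑U n m zero = begin
    x ^ n * z ^ m * 1#                 ≈⟨ *-identityʳ _ ⟩
    x ^ n * z ^ m                      ≈⟨ *-cong (reflexive (P.cong (x ^_) (ℕₚ.*-identityʳ n))) (reflexive (P.cong (z ^_) (ℕₚ.*-identityʳ m))) ⟨
    x ^ (n ℕ.* 1) * z ^ (m ℕ.* 1)      ≈⟨ *-congʳ (trans (*-congˡ ι-1) (*-identityʳ _)) ⟨
    mono (n ℕ.* 1) K.1# (m ℕ.* 1)      ≈⟨ sumTo-single ((n ℕ.* 1) ⊓ (m ℕ.* 1)) 0 F z≤n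
                                            (λ { zero _ 0≢0 → ⊥-elim (0≢0 P.refl)
                                               ; (suc l) _ _ → mono≈0 (n ℕ.* 1 ∸ suc l) (m ℕ.* 1 ∸ suc l) K.refl }) ⟨
    sumTo ((n ℕ.* 1) ⊓ (m ℕ.* 1)) F    ∎
    where
    F : ℕ → Carrier
    F l = mono (n ℕ.* 1 ∸ l) (U n m 1 l) (m ℕ.* 1 ∸ l)
  [x^n*z^m]^[s+1]≈∑U n m (suc s) = begin
    (x ^ n * z ^ m) ^ suc (suc s)
      ≈⟨ ^-sucʳ _ (suc s) ⟩
    (x ^ n * z ^ m) ^ suc s * (x ^ n * z ^ m)
      ≈⟨ *-congʳ ([x^n*z^m]^[s+1]≈∑U n m s) ⟩
    sumTo (n′ ⊓ m′) (λ l → mono (n′ ∸ l) (U n m (suc s) l) (m′ ∸ l)) * (x ^ n * z ^ m)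
      ≈⟨ ∑mono*≈∑convolution n′ m′ m (n′ ⊓ m′) n (n′ ⊓ m′ ℕ.+ n) (U n m (suc s)) (λ l → W n (m′ ∸ l)) (x ^ n * z ^ m)
           (ℕₚ.m⊓n≤m n′ m′) (ℕₚ.m⊓n≤n n′ m′) ℕₚ.≤-refl (λ l n′⊓m′<l → U≈0 n m s l (m⊓n<o⇒m<o⊎n<o n′⊓m′<l))
           (λ l k n<k → W≈0 n (m′ ∸ l) k (inj₁ n<k)) z^*x^n*z^m ⟩
    sumTo (n′ ⊓ m′ ℕ.+ n) (λ j → mono (n′ ℕ.+ n ∸ j) (ΣK.convolution (U n m (suc s)) (λ l → W n (m′ ∸ l)) j) (m′ ℕ.+ m ∸ j))
      ≈⟨ sumTo-cong (n′ ⊓ m′ ℕ.+ n) (λ j _ → trans (*-congʳ (*-congˡ (ι-cong (U-convolution n m s j))))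
           (mono-cong (P.cong (_∸ j) (P.trans (ℕₚ.+-comm n′ n) (P.sym (ℕₚ.*-suc n (suc s))))) K.refl
                      (P.cong (_∸ j) (P.trans (ℕₚ.+-comm m′ m) (P.sym (ℕₚ.*-suc m (suc s))))))) ⟩
    sumTo (n′ ⊓ m′ ℕ.+ n) F
      ≈⟨ sumTo-extend L (n′ ⊓ m′ ℕ.+ n) F (n[s+2]⊓m[s+2]≤n[s+1]⊓m[s+1]+n n m s)
           (λ j L<j _ → mono≈0 (n ℕ.* suc (suc s) ∸ j) (m ℕ.* suc (suc s) ∸ j) (U≈0 n m (suc s) j (m⊓n<o⇒m<o⊎n<o L<j))) ⟩
    sumTo L F ∎
    where
    n′ = n ℕ.* suc s
    m′ = m ℕ.* suc s
    L = (n ℕ.* suc (suc s)) ⊓ (m ℕ.* suc (suc s))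
    F : ℕ → Carrier
    F j = mono (n ℕ.* suc (suc s) ∸ j) (U n m (suc (suc s)) j) (m ℕ.* suc (suc s) ∸ j)
    z^*x^n*z^m : ∀ l → l ≤ n′ ⊓ m′ → z ^ (m′ ∸ l) * (x ^ n * z ^ m)
                   ≈ sumTo n (λ k → mono (n ∸ k) (W n (m′ ∸ l) k) (m′ ∸ l ℕ.+ m ∸ k))
    z^*x^n*z^m l _ = begin
      z ^ (m′ ∸ l) * (x ^ n * z ^ m)   ≈⟨ *-assoc _ _ _ ⟨
      z ^ (m′ ∸ l) * x ^ n * z ^ m     ≈⟨ *-congʳ (z^n*x^m≈∑Wᵐ n (m′ ∸ l)) ⟩
      sumTo n (λ k → mono (n ∸ k) (W n (m′ ∸ l) k) (m′ ∸ l ∸ k)) * z ^ m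
        ≈⟨ ∑mono*z^ n n (m′ ∸ l) m (W n (m′ ∸ l)) (λ k m′∸l<k → W≈0 n (m′ ∸ l) k (inj₂ m′∸l<k)) ⟩
      sumTo n (λ k → mono (n ∸ k) (W n (m′ ∸ l) k) (m′ ∸ l ℕ.+ m ∸ k)) ∎

  x^*mono : ∀ p i a k → x ^ p * mono i a k ≈ mono (p ℕ.+ i) a k
  x^*mono p i a k = begin
    x ^ p * (x ^ i * ι a * z ^ k)   ≈⟨ *-assoc _ _ _ ⟨
    x ^ p * (x ^ i * ι a) * z ^ k   ≈⟨ *-congʳ (*-assoc _ _ _) ⟨
    x ^ p * x ^ i * ι a * z ^ k     ≈⟨ *-congʳ (*-congʳ (^-homo-* x p i)) ⟨
    mono (p ℕ.+ i) a k              ∎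

  z^r*[x^n*z^t]^c : ∀ t n c j a → a ≤ t ℕ.* j → z ^ (t ℕ.* j ∸ a) * (x ^ n * z ^ t) ^ c
    ≈ sumTo (c ℕ.* n) (λ l → mono (c ℕ.* n ∸ l) (Caux t n j c a l) (t ℕ.* j ∸ a ℕ.+ c ℕ.* t ∸ l))
  z^r*[x^n*z^t]^c t n zero    j a _    = begin
    z ^ (t ℕ.* j ∸ a) * 1#          ≈⟨ *-identityʳ _ ⟩
    z ^ (t ℕ.* j ∸ a)               ≈⟨ reflexive (P.cong (z ^_) (ℕₚ.+-identityʳ (t ℕ.* j ∸ a))) ⟨
    z ^ (t ℕ.* j ∸ a ℕ.+ 0)         ≈⟨ trans (*-congʳ (trans (*-identityˡ _) ι-1)) (*-identityˡ _) ⟨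
    mono 0 K.1# (t ℕ.* j ∸ a ℕ.+ 0) ∎
  z^r*[x^n*z^t]^c t n (suc c) j a a≤tj = begin
    z ^ r * (x ^ n * z ^ t * Y)
      ≈⟨ trans (*-congˡ (*-assoc _ _ _)) (sym (*-assoc _ _ _)) ⟩
    z ^ r * x ^ n * (z ^ t * Y)
      ≈⟨ trans (*-congʳ (z^n*x^m≈∑zxCoeff n r)) (sym (*-assoc _ _ _)) ⟩
    sumTo (n ⊓ r) (λ k → mono (n ∸ k) (Θ r n k) (r ∸ k)) * z ^ t * Y
      ≈⟨ *-congʳ (∑mono*z^ (n ⊓ r) n r t (Θ r n) (λ k r<k → Θ≈0 r n k (inj₂ r<k))) ⟩
    sumTo (n ⊓ r) (λ k → mono (n ∸ k) (Θ r n k) (r ℕ.+ t ∸ k)) * Y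
      ≈⟨ ∑mono*≈∑convolution n (r ℕ.+ t) (c ℕ.* t) (n ⊓ r) (c ℕ.* n) (n ℕ.+ c ℕ.* n) (Θ r n)
           (λ k → Caux t n (suc j) c (a ℕ.+ k)) Y
           (ℕₚ.m⊓n≤m n r) (ℕₚ.≤-trans (ℕₚ.m⊓n≤n n r) (ℕₚ.m≤m+n r t)) (ℕₚ.+-monoˡ-≤ (c ℕ.* n) (ℕₚ.m⊓n≤m n r))
           (λ k n⊓r<k → Θ≈0 r n k (m⊓n<o⇒m<o⊎n<o n⊓r<k))
           (λ k l cn<l → Caux≈0ˡ t n c (suc j) (a ℕ.+ k) l cn<l)
           z^*Y ⟩
    sumTo (n ℕ.+ c ℕ.* n) (λ l → mono (n ℕ.+ c ℕ.* n ∸ l) (Caux t n j (suc c) a l) (r ℕ.+ t ℕ.+ c ℕ.* t ∸ l))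
      ≈⟨ sumTo-cong (n ℕ.+ c ℕ.* n) (λ l _ → mono-cong {i = n ℕ.+ c ℕ.* n ∸ l} P.refl K.refl (P.cong (_∸ l) (ℕₚ.+-assoc r t (c ℕ.* t)))) ⟩
    sumTo (suc c ℕ.* n) (λ l → mono (suc c ℕ.* n ∸ l) (Caux t n j (suc c) a l) (r ℕ.+ suc c ℕ.* t ∸ l)) ∎
    where
    r = t ℕ.* j ∸ a
    Y = (x ^ n * z ^ t) ^ c
    z^*Y : ∀ k → k ≤ n ⊓ r → z ^ (r ℕ.+ t ∸ k) * Y
             ≈ sumTo (c ℕ.* n) (λ l → mono (c ℕ.* n ∸ l) (Caux t n (suc j) c (a ℕ.+ k) l) (r ℕ.+ t ∸ k ℕ.+ c ℕ.* t ∸ l))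
    z^*Y k k≤n⊓r = P.subst (λ e → z ^ e * Y ≈ sumTo (c ℕ.* n) (λ l → mono (c ℕ.* n ∸ l) (Caux t n (suc j) c (a ℕ.+ k) l) (e ℕ.+ c ℕ.* t ∸ l)))
                     exponent (z^r*[x^n*z^t]^c t n c (suc j) (a ℕ.+ k) (a≤tj⇒a+k≤t[j+1] t j a a≤tj k≤r))
      where
      k≤r = ℕₚ.≤-trans k≤n⊓r (ℕₚ.m⊓n≤n n r)
      exponent : t ℕ.* suc j ∸ (a ℕ.+ k) ≡ r ℕ.+ t ∸ k
      exponent = P.trans (P.cong (_∸ (a ℕ.+ k)) (ℕₚ.*-suc t j))
                 (P.trans (P.sym (ℕₚ.∸-+-assoc (t ℕ.+ t ℕ.* j) a k))
                 (P.cong (_∸ k) (P.trans (ℕₚ.+-∸-assoc t a≤tj) (ℕₚ.+-comm t r))))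

  [x^n*z^t]^[s+1]≈∑𝒞 : ∀ n t s → (x ^ n * z ^ t) ^ suc s
    ≈ sumTo (n ℕ.* suc s ⊓ t ℕ.* suc s) (λ l → mono (n ℕ.* suc s ∸ l) (𝒞 n t (suc s) l) (t ℕ.* suc s ∸ l))
  [x^n*z^t]^[s+1]≈∑𝒞 n t s = begin
    x ^ n * z ^ t * (x ^ n * z ^ t) ^ s
      ≈⟨ trans (*-assoc _ _ _) (*-congˡ (*-congʳ (reflexive (P.cong (z ^_) (P.sym (ℕₚ.*-identityʳ t)))))) ⟩
    x ^ n * (z ^ (t ℕ.* 1 ∸ 0) * (x ^ n * z ^ t) ^ s)
      ≈⟨ *-congˡ (z^r*[x^n*z^t]^c t n s 1 0 z≤n) ⟩
    x ^ n * sumTo (s ℕ.* n) (λ l → mono (s ℕ.* n ∸ l) (Caux t n 1 s 0 l) (t ℕ.* 1 ℕ.+ s ℕ.* t ∸ l))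
      ≈⟨ *-distribˡ-sumTo (s ℕ.* n) _ _ ⟩
    sumTo (s ℕ.* n) (λ l → x ^ n * mono (s ℕ.* n ∸ l) (Caux t n 1 s 0 l) (t ℕ.* 1 ℕ.+ s ℕ.* t ∸ l))
      ≈⟨ sumTo-cong (s ℕ.* n) (λ l l≤sn → trans (x^*mono n (s ℕ.* n ∸ l) (Caux t n 1 s 0 l) (t ℕ.* 1 ℕ.+ s ℕ.* t ∸ l))
           (reflexive (P.cong₂ (λ i e → mono i (Caux t n 1 s 0 l) (e ∸ l))
             (P.trans (P.sym (ℕₚ.+-∸-assoc n l≤sn)) (P.cong (_∸ l) (x-exponent n s))) (z-exponent t s)))) ⟩
    sumTo (s ℕ.* n) F
      ≈⟨ sumTo-resize L′ (s ℕ.* n) (n ℕ.* suc s ⊓ t ℕ.* suc s) F (ℕₚ.m⊓n≤m _ _)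
           (ℕₚ.≤-trans (ℕₚ.⊓-monoˡ-≤ (t ℕ.* suc s) (ℕₚ.≤-trans (ℕₚ.m≤n+m (s ℕ.* n) n) (ℕₚ.≤-reflexive (x-exponent n s))))
                       (a⊓[c*s]≤[a⊓c]*s (n ℕ.* suc s) t s))
           (λ l L′<l → mono≈0 (n ℕ.* suc s ∸ l) (t ℕ.* suc s ∸ l) (𝒞≈0 n t s l (m⊓n<o⇒m<o⊎n<o L′<l))) ⟩
    sumTo (n ℕ.* suc s ⊓ t ℕ.* suc s) F ∎
    where
    L′ = (s ℕ.* n) ⊓ (t ℕ.* suc s)
    F : ℕ → Carrier
    F l = mono (n ℕ.* suc s ∸ l) (𝒞 n t (suc s) l) (t ℕ.* suc s ∸ l)
    x-exponent : ∀ n s → n ℕ.+ s ℕ.* n ≡ n ℕ.* suc s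
    x-exponent = solve-∀
    z-exponent : ∀ t s → t ℕ.* 1 ℕ.+ s ℕ.* t ≡ t ℕ.* suc s
    z-exponent = solve-∀

  y^*mono : ∀ M i a k → y ^ M * mono i a k ≈ x ^ i * y ^ M * ι a * z ^ k
  y^*mono M i a k = begin
    y ^ M * (x ^ i * ι a * z ^ k)   ≈⟨ *-assoc _ _ _ ⟨
    y ^ M * (x ^ i * ι a) * z ^ k   ≈⟨ *-congʳ (*-assoc _ _ _) ⟨
    y ^ M * x ^ i * ι a * z ^ k     ≈⟨ *-congʳ (*-congʳ (^-comm (sym xy≈yx) M i)) ⟩
    x ^ i * y ^ M * ι a * z ^ k     ∎

  [x^n*y^m*z^t]^s : ∀ n m t s → (x ^ n * y ^ m * z ^ t) ^ s ≈ y ^ (m ℕ.* s) * (x ^ n * z ^ t) ^ s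
  [x^n*y^m*z^t]^s n m t s = begin
    (x ^ n * y ^ m * z ^ t) ^ s       ≈⟨ ^-congˡ s (trans (*-congʳ (^-comm xy≈yx n m)) (*-assoc _ _ _)) ⟩
    (y ^ m * (x ^ n * z ^ t)) ^ s     ≈⟨ ^-distrib-* (*-commutes (^-comm (sym xy≈yx) m n) (^-comm yz≈zy m t)) s ⟩
    (y ^ m) ^ s * (x ^ n * z ^ t) ^ s ≈⟨ *-congʳ (^-assocʳ y m s) ⟩
    y ^ (m ℕ.* s) * (x ^ n * z ^ t) ^ s ∎

  [x*y*z]^s : ∀ s → (x * y * z) ^ s ≈ y ^ s * (x * z) ^ s
  [x*y*z]^s s = trans (^-congˡ s (trans (*-congʳ xy≈yx) (*-assoc _ _ _)))
                      (^-distrib-* (*-commutes (sym xy≈yx) yz≈zy) s)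

  [x^n*y^m*z^t]^[s+1]≈∑𝒞 : ∀ n m t s → (x ^ n * y ^ m * z ^ t) ^ suc s
    ≈ sumTo (n ℕ.* suc s ⊓ t ℕ.* suc s)
        (λ l → x ^ (n ℕ.* suc s ∸ l) * y ^ (m ℕ.* suc s) * ι (𝒞 n t (suc s) l) * z ^ (t ℕ.* suc s ∸ l))
  [x^n*y^m*z^t]^[s+1]≈∑𝒞 n m t s = begin
    (x ^ n * y ^ m * z ^ t) ^ suc s           ≈⟨ [x^n*y^m*z^t]^s n m t (suc s) ⟩
    y ^ (m ℕ.* suc s) * (x ^ n * z ^ t) ^ suc s ≈⟨ *-congˡ ([x^n*z^t]^[s+1]≈∑𝒞 n t s) ⟩
    y ^ (m ℕ.* suc s) * sumTo L _             ≈⟨ *-distribˡ-sumTo L _ _ ⟩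
    sumTo L _                                 ≈⟨ sumTo-cong L (λ l _ → y^*mono (m ℕ.* suc s) (n ℕ.* suc s ∸ l) _ (t ℕ.* suc s ∸ l)) ⟩
    sumTo L _                                 ∎
    where L = n ℕ.* suc s ⊓ t ℕ.* suc s

  mono*z : ∀ i a k → mono i a k * z ≈ mono i a (suc k)
  mono*z i a k = trans (*-assoc _ _ _) (*-congˡ (sym (^-sucʳ z k)))

  z^e*[x*z] : ∀ e → z ^ e * (x * z) ≈ sumTo 1 (λ k → mono (1 ∸ k) (xzCoeff e k) (e ℕ.+ 1 ∸ k))
  z^e*[x*z] e = begin
    z ^ e * (x * z)                                                   ≈⟨ *-assoc _ _ _ ⟨
    z ^ e * x * z                                                     ≈⟨ *-congʳ (z^j*x e) ⟩
    (mono 1 (β ^ᴷ e) e + mono 0 (b *ᴷ qint β e) (e ∸ 1)) * z         ≈⟨ distribʳ _ _ _ ⟩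
    mono 1 (β ^ᴷ e) e * z + mono 0 (b *ᴷ qint β e) (e ∸ 1) * z       ≈⟨ +-cong (mono*z 1 _ e) (mono*z 0 _ (e ∸ 1)) ⟩
    mono 1 (β ^ᴷ e) (suc e) + mono 0 (b *ᴷ qint β e) (suc (e ∸ 1))
      ≈⟨ +-cong (reflexive (P.cong (mono 1 (β ^ᴷ e)) (ℕₚ.+-comm 1 e)))
                (trans (mono-predᶻ 0 _ e λ { P.refl → K.zeroʳ b })
                       (reflexive (P.cong (mono 0 (b *ᴷ qint β e)) (P.sym (ℕₚ.m+n∸n≡m e 1))))) ⟩
    mono 1 (β ^ᴷ e) (e ℕ.+ 1) + mono 0 (b *ᴷ qint β e) (e ℕ.+ 1 ∸ 1) ∎

  [x*z]^[s+1]≈∑V : ∀ s → (x * z) ^ suc s ≈ sumTo (suc s) (λ l → mono (suc s ∸ l) (V (suc s) l) (suc s ∸ l))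
  [x*z]^[s+1]≈∑V zero    = begin
    x * z * 1#                            ≈⟨ *-identityʳ _ ⟩
    x * z                                 ≈⟨ +-identityʳ _ ⟨
    x * z + 0#                            ≈⟨ +-cong (*-cong (trans (*-congˡ ι-1) (trans (*-identityʳ _) (*-identityʳ x))) (*-identityʳ z))
                                                    (mono≈0 0 0 K.refl) ⟨
    mono 1 K.1# 1 + mono 0 K.0# 0         ∎
  [x*z]^[s+1]≈∑V (suc s) = begin
    (x * z) ^ suc (suc s)                 ≈⟨ ^-sucʳ _ (suc s) ⟩
    (x * z) ^ suc s * (x * z)             ≈⟨ *-congʳ ([x*z]^[s+1]≈∑V s) ⟩
    sumTo (suc s) (λ l → mono (suc s ∸ l) (V (suc s) l) (suc s ∸ l)) * (x * z)
      ≈⟨ ∑mono*≈∑convolution (suc s) (suc s) 1 (suc s) 1 (suc s ℕ.+ 1) (V (suc s)) (λ l → xzCoeff (suc s ∸ l)) (x * z)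
           ℕₚ.≤-refl ℕₚ.≤-refl ℕₚ.≤-refl (V≈0 s) (λ l k 1<k → 1<k⇒xzCoeff≈0 (suc s ∸ l) 1<k)
           (λ l _ → z^e*[x*z] (suc s ∸ l)) ⟩
    sumTo (suc s ℕ.+ 1) (λ j → mono (suc s ℕ.+ 1 ∸ j) (ΣK.convolution (V (suc s)) (λ l → xzCoeff (suc s ∸ l)) j) (suc s ℕ.+ 1 ∸ j))
      ≈⟨ sumTo-cong (suc s ℕ.+ 1) (λ j _ → *-congʳ (*-congˡ (ι-cong (V-convolution s j)))) ⟩
    sumTo (suc s ℕ.+ 1) (λ j → mono (suc s ℕ.+ 1 ∸ j) (V (suc (suc s)) j) (suc s ℕ.+ 1 ∸ j))
      ≈⟨ reflexive (P.cong (λ e → sumTo e (λ j → mono (e ∸ j) (V (suc (suc s)) j) (e ∸ j))) (ℕₚ.+-comm (suc s) 1)) ⟩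
    sumTo (suc (suc s)) (λ j → mono (suc (suc s) ∸ j) (V (suc (suc s)) j) (suc (suc s) ∸ j)) ∎

  [x*y*z]^[s+1]≈∑V : ∀ s → (x * y * z) ^ suc s
    ≈ sumTo (suc s) (λ l → x ^ (suc s ∸ l) * ι (V (suc s) l) * y ^ suc s * z ^ (suc s ∸ l))
  [x*y*z]^[s+1]≈∑V s = begin
    (x * y * z) ^ suc s                 ≈⟨ [x*y*z]^s (suc s) ⟩
    y ^ suc s * (x * z) ^ suc s         ≈⟨ *-congˡ ([x*z]^[s+1]≈∑V s) ⟩
    y ^ suc s * sumTo (suc s) _         ≈⟨ *-distribˡ-sumTo (suc s) _ _ ⟩
    sumTo (suc s) _                     ≈⟨ sumTo-cong (suc s) (λ l _ → trans (y^*mono (suc s) (suc s ∸ l) _ (suc s ∸ l)) (y-past-ι _ _ _)) ⟩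
    sumTo (suc s) _                     ∎
    where
    y-past-ι : ∀ u a w → u * y ^ suc s * ι a * w ≈ u * ι a * y ^ suc s * w
    y-past-ι u a w = *-congʳ (trans (*-assoc _ _ _) (trans (*-congˡ (sym (ι-central a _))) (sym (*-assoc _ _ _))))

  ×≈natA* : ∀ c u → c × u ≈ natA c * u
  ×≈natA* zero    u = sym (trans (*-congʳ ι-0) (zeroˡ u))
  ×≈natA* (suc c) u = begin
    u + c × u                     ≈⟨ +-cong (sym (*-identityˡ u)) (×≈natA* c u) ⟩
    1# * u + natA c * u           ≈⟨ distribʳ _ _ _ ⟨
    (1# + natA c) * u             ≈⟨ *-congʳ (trans (+-congʳ (sym ι-1)) (sym (ι-+ _ _))) ⟩
    natA (suc c) * u              ∎

  binomial : ∀ {u v} → u * v ≈ v * u → ∀ n → (u + v) ^ n ≈ sumTo n (λ k → natA (n C k) * u ^ (n ∸ k) * v ^ k)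
  binomial uv≈vu n = trans (binomial-theorem uv≈vu n)
    (sumTo-cong n (λ k _ → trans (×≈natA* (n C k) _) (sym (*-assoc _ _ _))))

  mono*[x+z] : ∀ i a k → mono i a k * (x + z)
    ≈ mono i a (suc k) + (mono (suc i) (β ^ᴷ k *ᴷ a) k + mono i (b *ᴷ qint β k *ᴷ a) (k ∸ 1))
  mono*[x+z] i a k = begin
    mono i a k * (x + z)                  ≈⟨ trans (distribˡ _ _ _) (+-comm _ _) ⟩
    mono i a k * z + mono i a k * x       ≈⟨ +-cong (mono*z i a k) (*-assoc _ _ _) ⟩
    mono i a (suc k) + x ^ i * ι a * (z ^ k * x)
      ≈⟨ +-congˡ (trans (*-congˡ (z^j*x k)) (distribˡ _ _ _)) ⟩
    mono i a (suc k) + (x ^ i * ι a * mono 1 (β ^ᴷ k) k + x ^ i * ι a * mono 0 (b *ᴷ qint β k) (k ∸ 1))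
      ≈⟨ +-congˡ (+-cong (trans (x^-ι-*-mono i a 1 _ k) (mono-cong {k = k} (ℕₚ.+-comm i 1) (K.*-comm _ _) P.refl))
                         (trans (x^-ι-*-mono i a 0 _ (k ∸ 1)) (mono-cong {k = k ∸ 1} (ℕₚ.+-identityʳ i) (K.*-comm _ _) P.refl))) ⟩
    mono i a (suc k) + (mono (suc i) (β ^ᴷ k *ᴷ a) k + mono i (b *ᴷ qint β k *ᴷ a) (k ∸ 1)) ∎

  [x+z]^n≈∑∑E : ∀ n → (x + z) ^ n ≈ ∑∑ n (λ i k → mono i (E n i k) k)
  [x+z]^n≈∑∑E zero    = sym (trans (*-identityʳ _) (trans (*-identityˡ _) ι-1))
  [x+z]^n≈∑∑E (suc n) = begin
    (x + z) ^ suc n                                  ≈⟨ ^-sucʳ _ n ⟩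
    (x + z) ^ n * (x + z)                            ≈⟨ *-congʳ ([x+z]^n≈∑∑E n) ⟩
    ∑∑ n T * (x + z)                                 ≈⟨ *-distribʳ-∑∑ n T (x + z) ⟩
    ∑∑ n (λ i k → T i k * (x + z))                   ≈⟨ ∑∑-cong n (λ i k → mono*[x+z] i (E n i k) k) ⟩
    ∑∑ n (λ i k → Tz i k + (Tx₁ i k + Tx₂ i k))       ≈⟨ trans (∑∑-+ n Tz _) (+-congˡ (∑∑-+ n Tx₁ Tx₂)) ⟩
    ∑∑ n Tz + (∑∑ n Tx₁ + ∑∑ n Tx₂)                  ≈⟨ +-cong ∑∑Tz (+-cong ∑∑Tx₁ ∑∑Tx₂) ⟩
    ∑∑ (suc n) Q₁ + (∑∑ (suc n) Q₂ + ∑∑ (suc n) Q₃)  ≈⟨ trans (∑∑-+ (suc n) Q₁ _) (+-congˡ (∑∑-+ (suc n) Q₂ Q₃)) ⟨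
    ∑∑ (suc n) (λ i k → Q₁ i k + (Q₂ i k + Q₃ i k))  ≈⟨ ∑∑-cong (suc n) (λ i k → sym (E-suc-mono i k)) ⟩
    ∑∑ (suc n) (λ i k → mono i (E (suc n) i k) k)    ∎
    where
    T Tz Tx₁ Tx₂ Q₁ Q₂ Q₃ : ℕ → ℕ → Carrier
    T   i k = mono i (E n i k) k
    Tz  i k = mono i (E n i k) (suc k)
    Tx₁ i k = mono (suc i) (β ^ᴷ k *ᴷ E n i k) k
    Tx₂ i k = mono i (b *ᴷ qint β k *ᴷ E n i k) (k ∸ 1)
    Q₁  i k = mono i (E[k-1] n i k) k
    Q₂  i k = mono i (βᵏE[i-1] n i k) k
    Q₃  i k = mono i (b *ᴷ qint β (suc k) *ᴷ E n i (suc k)) k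
    E-suc-mono : ∀ i k → mono i (E (suc n) i k) k ≈ Q₁ i k + (Q₂ i k + Q₃ i k)
    E-suc-mono i k = trans (*-congʳ (*-congˡ (ι-cong (E-suc n i k))))
                     (trans (mono-+ i _ _ k) (trans (+-congʳ (mono-+ i _ _ k)) (+-assoc _ _ _)))
    c*E≈0 : ∀ c {i k} → n < i ℕ.+ k → c *ᴷ E n i k K.≈ K.0#
    c*E≈0 c n<i+k = ΣK.*-zeroʳ-≈ c (E≈0 n _ _ n<i+k)
    n<n+1+k : ∀ k → n < suc n ℕ.+ k
    n<n+1+k k = ℕₚ.m≤n⇒m≤n+o k (ℕₚ.n<1+n n)
    n<i+n+1 : ∀ i → n < i ℕ.+ suc n
    n<i+n+1 i = ℕₚ.m≤n⇒m≤o+n i (ℕₚ.n<1+n n)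
    ∑∑Tz : ∑∑ n Tz ≈ ∑∑ (suc n) Q₁
    ∑∑Tz = sym (trans (sumTo-init n _ (sumTo-zero (suc n) _ (λ k _ → mono≈0 (suc n) k (E[k-1]-last k))))
                      (sumTo-cong n (λ i _ → sumTo-tail n (Q₁ i) (mono≈0 i 0 K.refl))))
      where
      E[k-1]-last : ∀ k → E[k-1] n (suc n) k K.≈ K.0#
      E[k-1]-last zero    = K.refl
      E[k-1]-last (suc k) = E≈0 n (suc n) k (n<n+1+k k)
    ∑∑Tx₁ : ∑∑ n Tx₁ ≈ ∑∑ (suc n) Q₂
    ∑∑Tx₁ = sym (trans (sumTo-tail n _ (sumTo-zero (suc n) _ (λ k _ → mono≈0 0 k K.refl)))
                       (sumTo-cong n (λ i _ → sumTo-init n (Tx₁ i) (mono≈0 (suc i) (suc n) (c*E≈0 _ (n<i+n+1 i))))))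
    ∑∑Tx₂ : ∑∑ n Tx₂ ≈ ∑∑ (suc n) Q₃
    ∑∑Tx₂ = sym (trans (sumTo-init n _ (sumTo-zero (suc n) _ (λ k _ → mono≈0 (suc n) k (c*E≈0 _ (n<n+1+k (suc k))))))
                       (sumTo-cong n (λ i _ → row i)))
      where
      row : ∀ i → sumTo (suc n) (Q₃ i) ≈ sumTo n (Tx₂ i)
      row i = begin
        sumTo (suc n) (Q₃ i)
          ≈⟨ sumTo-init n (Q₃ i) (mono≈0 i (suc n) (c*E≈0 _ (ℕₚ.<-trans (n<i+n+1 i) (ℕₚ.+-monoʳ-< i (ℕₚ.n<1+n (suc n)))))) ⟩
        sumTo n (Q₃ i)         ≈⟨ sumTo-tail n (Tx₂ i) (mono≈0 i 0 (ΣK.*-zeroˡ-≈ _ (K.zeroʳ b))) ⟨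
        sumTo (suc n) (Tx₂ i)  ≈⟨ sumTo-init n (Tx₂ i) (mono≈0 i n (c*E≈0 _ (n<i+n+1 i))) ⟩
        sumTo n (Tx₂ i)        ∎

  [x^n*z^m]^[s+1]≈∑U-widened : ∀ n m s → (x ^ n * z ^ m) ^ suc s
    ≈ sumTo (n ℕ.* suc s ⊓ m ℕ.* suc s) (λ l → mono (n ℕ.* suc s ∸ l) (U n m (suc s) l) (m ℕ.* suc s ∸ l))
  [x^n*z^m]^[s+1]≈∑U-widened n m s = trans ([x^n*z^m]^[s+1]≈∑U n m s)
    (sym (sumTo-extend _ _ _ (a⊓[c*s]≤[a⊓c]*s (n ℕ.* suc s) m s)
      (λ l L<l _ → mono≈0 (n ℕ.* suc s ∸ l) (m ℕ.* suc s ∸ l) (U≈0 n m s l (m⊓n<o⇒m<o⊎n<o L<l)))))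

  [x+z]^n≈∑E : ∀ n → (x + z) ^ n ≈ sumTo n (λ i → sumTo (n ∸ i) (λ k → mono i (E n i k) k))
  [x+z]^n≈∑E n = trans ([x+z]^n≈∑∑E n) (sumTo-cong n (λ i _ →
    sumTo-extend (n ∸ i) n _ (ℕₚ.m∸n≤m n i) (λ k n∸i<k _ → mono≈0 i k (E≈0 n i k (n<i+k k n∸i<k)))))
    where
    n<i+k : ∀ {i} k → n ∸ i < k → n < i ℕ.+ k
    n<i+k {i} k n∸i<k = ℕₚ.≤-<-trans (ℕₚ.m≤n+m∸n n i) (ℕₚ.+-monoʳ-< i n∸i<k)

open import Data.Product using (_×_; _,_)

proposition3p5 : ∀ {c ℓ c′ ℓ′ : Level} (S : Setting c ℓ c′ ℓ′) → let open Setting S in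
    -- (1)
    ((∀ m n → y ^ n * x ^ m ≈ x ^ m * y ^ n)
     × (∀ m n → z ^ n * y ^ m ≈ y ^ m * z ^ n)
     × (∀ m n → z ^ n * x ^ m
                  ≈ sumTo (m ⊓ n) (λ k → ι (zxCoeff n m k) * x ^ (m ∸ k) * z ^ (n ∸ k)))
     × (∀ m n → z ^ n * x ^ m
                  ≈ sumTo (m ⊓ n) (λ k → x ^ (m ∸ k) * ι (W m n k) * z ^ (n ∸ k)))
     × (∀ m n k → k ≤ m ⊓ n → CommutativeRing._≈_ K (W m n k) (zxCoeff n m k)))
    -- (2)
    × ((∀ m n s → (x ^ n * y ^ m) ^ s ≈ x ^ (n ℕ.* s) * y ^ (m ℕ.* s))
     × (∀ m n s → (y ^ n * z ^ m) ^ s ≈ y ^ (n ℕ.* s) * z ^ (m ℕ.* s))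
     × (∀ m n s → s ≥ 1 → (x ^ n * z ^ m) ^ s
                  ≈ sumTo (n ℕ.* s ⊓ m ℕ.* s)
                      (λ l → x ^ (n ℕ.* s ∸ l) * ι (U n m s l) * z ^ (m ℕ.* s ∸ l))))
    -- (3)
    × ((∀ s → (x * y * z) ^ s ≈ y ^ s * (x * z) ^ s)
     × (∀ s → s ≥ 1 → (x * y * z) ^ s
                  ≈ sumTo s (λ l → x ^ (s ∸ l) * ι (V s l) * y ^ s * z ^ (s ∸ l))))
    -- (4)
    × ((∀ r n → z ^ r * x ^ n
                  ≈ sumTo (r ⊓ n) (λ k → ι (Θ r n k) * x ^ (n ∸ k) * z ^ (r ∸ k)))
     × (∀ n m t s → s ≥ 1 → (x ^ n * y ^ m * z ^ t) ^ s
                  ≈ sumTo (n ℕ.* s ⊓ t ℕ.* s)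
                      (λ l → x ^ (n ℕ.* s ∸ l) * y ^ (m ℕ.* s) * ι (𝒞 n t s l)
                               * z ^ (t ℕ.* s ∸ l))))
    -- (5)
    × ((∀ n → (x + y) ^ n ≈ sumTo n (λ k → natA (n C k) * x ^ (n ∸ k) * y ^ k))
     × (∀ n → (y + z) ^ n ≈ sumTo n (λ k → natA (n C k) * y ^ (n ∸ k) * z ^ k))
     × (∀ n → (x + z) ^ n
                  ≈ sumTo n (λ i → sumTo (n ∸ i) (λ k → x ^ i * ι (E n i k) * z ^ k))))
proposition3p5 S =
  ( (λ m n → ^-comm (sym xy≈yx) n m)
  , (λ m n → ^-comm (sym yz≈zy) n m)
  , z^n*x^m≈∑ι[zxCoeff]
  , z^n*x^m≈∑W⊓
  , (λ m n k k≤m⊓n → W≈zxCoeff m n k (ℕₚ.m≤n⊓o⇒m≤n m n k≤m⊓n)) )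
  , ( (λ m n → [u^n*v^m]^s xy≈yx n m)
    , (λ m n → [u^n*v^m]^s yz≈zy n m)
    , (λ { m n (suc s) _ → [x^n*z^m]^[s+1]≈∑U-widened n m s }) )
  , ( [x*y*z]^s
    , (λ { (suc s) _ → [x*y*z]^[s+1]≈∑V s }) )
  , ( z^r*x^n≈∑Θ
    , (λ { n m t (suc s) _ → [x^n*y^m*z^t]^[s+1]≈∑𝒞 n m t s }) )
  , ( binomial xy≈yx
    , binomial yz≈zy
    , [x+z]^n≈∑E )
  where
  open Setting S
  open NormalOrdering S
  open Commuting semiring using (^-comm; [u^n*v^m]^s)
  open Coefficients K β b using (W≈zxCoeff)
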